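{- Let $G$ be a finite graph with vertex set $U \sqcup V$ such that $uu'$ and $vv'$ are edges of $G$ for all distinct $u,u' \in U$ and all distinct $v,v' \in V$. Let $G'$ be the bipartite graph on (a subset of) $U \sqcup V$ obtained from $G$ by deleting all edges $uu'$ with $u,u'\in U$ and all edges $vv'$ with $v,v'\in V$, and then deleting all isolated vertices. Then $\tilde{\beta}_1(X(G)) = \tilde{\beta}_0(G')$. Moreover, if $G'$ has $q$ connected components and $u_iv_i$ ($u_i \in U$, $v_i \in V$, $1 \le i \le q$) is a representative edge of the $i$-th component, then the classes $[(u_1,u_i,v_i,v_1)]$ for $2 \leq i \leq q$ form a basis for $\tilde{H}_1(X(G))$.
   Context: $X(G)$ denotes the flag (clique) complex of $G$: the simplicial complex whose faces are the vertex sets of cliques of $G$. Homology and reduced Betti numbers $\tilde{\beta}_p$ are over a fixed field; $G'$ is regarded as a 1-dimensional complex, so $\tilde{\beta}_0(G')=\max\{0,q-1\}$ where $q$ is its number of connected components. For vertices $a_1,\dots,a_r$ forming a closed walk of edges, $[(a_1,\dots,a_r)]$ is the homology class of the 1-cycle $\sum \pm a_ia_{i+1}$ (indices mod $r$, signs chosen so the boundary vanishes). -}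

module Defs where

open import Level using (Level; _⊔_) renaming (suc to lsuc)
open import Algebra.Bundles using (CommutativeRing)
open import Data.Nat using (ℕ; zero; suc; _<ᵇ_; _≡ᵇ_)
open import Data.Fin using (Fin; toℕ)
open import Data.Bool using (Bool; true; false; _∧_; if_then_else_)
open import Data.List using (List; []; _∷_)
open import Data.Product using (Σ; _×_; _,_)
open import Relation.Nullary using (¬_)
open import Relation.Binary.PropositionalEquality using (_≡_; _≢_)
open import Relation.Binary.Construct.Closure.ReflexiveTransitive using (Star)

record Field (c ℓ : Level) : Set (lsuc (c ⊔ ℓ)) where
  field
    commRing : CommutativeRing c ℓ
  open CommutativeRing commRing public
  field
    1≉0 : ¬ (1# ≈ 0#)
    inverse : ∀ x → ¬ (x ≈ 0#) → Σ Carrier (λ y → x * y ≈ 1#)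

record Graph (n : ℕ) : Set where
  field
    adj : Fin n → Fin n → Bool
    adj-sym : ∀ i j → adj i j ≡ adj j i
    adj-irrefl : ∀ i → adj i i ≡ false

module GraphNotions {n : ℕ} (G : Graph n) where
  open Graph G

  Edge : Fin n → Fin n → Set
  Edge i j = adj i j ≡ true

  -- The side function: inU x ≡ true means x ∈ U, false means x ∈ V.
  -- Hypothesis of the lemma: U and V are cliques.
  CliqueSides : (Fin n → Bool) → Set
  CliqueSides inU = ∀ x y → x ≢ y → inU x ≡ inU y → Edge x y

  -- Edges of G' : the edges of G joining U and V.
  CrossEdge : (Fin n → Bool) → Fin n → Fin n → Set
  CrossEdge inU x y = Edge x y × (inU x ≢ inU y)

  Conn' : (Fin n → Bool) → Fin n → Fin n → Set
  Conn' inU = Star (CrossEdge inU)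

  -- "G' has exactly q connected components, and u k v k (u k ∈ U,
  -- v k ∈ V) is an edge of G' lying in the k-th component":
  -- the representatives lie in pairwise distinct components, and every
  -- vertex of G' (i.e. every endpoint of an edge of G') lies in the
  -- component of some representative.
  record ComponentReps (inU : Fin n → Bool) (q : ℕ)
                       (u v : Fin q → Fin n) : Set where
    field
      u-in-U : ∀ k → inU (u k) ≡ true
      v-in-V : ∀ k → inU (v k) ≡ false
      rep-edge : ∀ k → Edge (u k) (v k)
      distinct : ∀ k l → Conn' inU (u k) (u l) → k ≡ l
      cover : ∀ x y → CrossEdge inU x y →
              Σ (Fin q) (λ k → Conn' inU x (u k))

-- Simplicial chains of the flag complex X(G) over a field, in degrees
-- 0,1,2.  A simplex is written with increasing vertices; a 1-chain is a
-- function on pairs (i , j), of which only the values on edges with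
-- i < j matter; similarly 2-chains on triangles i < j < k.

module Homology {c ℓ : Level} (F : Field c ℓ) {n : ℕ} (G : Graph n) where
  open Field F
  open Graph G
  open GraphNotions G public

  sumF : ∀ {m} → (Fin m → Carrier) → Carrier
  sumF {zero} f = 0#
  sumF {suc m} f = f Fin.zero + sumF (λ k → f (Fin.suc k))

  lt : Fin n → Fin n → Bool
  lt i j = toℕ i <ᵇ toℕ j

  eqv : Fin n → Fin n → Bool
  eqv i j = toℕ i ≡ᵇ toℕ j

  guard : Bool → Carrier → Carrier
  guard b x = if b then x else 0#

  tri : Fin n → Fin n → Fin n → Bool
  tri i j k = adj i j ∧ adj j k ∧ adj i k

  C1 : Set c
  C1 = Fin n → Fin n → Carrier

  C2 : Set c
  C2 = Fin n → Fin n → Fin n → Carrier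

  -- ∂[a,b] = b - a
  ∂₁ : C1 → Fin n → Carrier
  ∂₁ x w = sumF (λ i → guard (lt i w ∧ adj i w) (x i w))
         - sumF (λ j → guard (lt w j ∧ adj w j) (x w j))

  -- ∂[a,b,c] = [b,c] - [a,c] + [a,b]; value on the edge [i,j], i < j
  ∂₂ : C2 → C1
  ∂₂ t i j = (sumF (λ k → guard (lt k i ∧ tri k i j) (t k i j))
            - sumF (λ k → guard (lt i k ∧ lt k j ∧ tri i k j) (t i k j)))
            + sumF (λ k → guard (lt j k ∧ tri i j k) (t i j k))

  IsCycle : C1 → Set ℓ
  IsCycle x = ∀ w → ∂₁ x w ≈ 0#

  zeroC : C1
  zeroC i j = 0#

  Homologous : C1 → C1 → Set (c ⊔ ℓ)
  Homologous x y = Σ C2 (λ t → ∀ i j → lt i j ≡ true → Edge i j →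
                                   x i j ≈ y i j + ∂₂ t i j)

  linComb : ∀ {m} → (Fin m → Carrier) → (Fin m → C1) → C1
  linComb a γ i j = sumF (λ k → a k * γ k i j)

  -- the homology classes of the cycles γ k form a basis of H̃₁(X(G))
  -- (= H₁(X(G))).
  IsH1Basis : (m : ℕ) → (Fin m → C1) → Set (c ⊔ ℓ)
  IsH1Basis m γ =
    (∀ k → IsCycle (γ k))
    × (∀ z → IsCycle z → Σ (Fin m → Carrier) (λ a → Homologous z (linComb a γ)))
    × (∀ a → Homologous (linComb a γ) zeroC → ∀ k → a k ≈ 0#)

  Betti1 : ℕ → Set (c ⊔ ℓ)
  Betti1 m = Σ (Fin m → C1) (IsH1Basis m)

  orientedEdge : Fin n → Fin n → C1
  orientedEdge a b i j = guard (eqv i a ∧ eqv j b) 1# - guard (eqv i b ∧ eqv j a) 1#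

  _+C_ : C1 → C1 → C1
  (x +C y) i j = x i j + y i j

  walkFrom : Fin n → List (Fin n) → C1
  walkFrom first [] = zeroC
  walkFrom first (a ∷ []) = orientedEdge a first
  walkFrom first (a ∷ b ∷ rest) = orientedEdge a b +C walkFrom first (b ∷ rest)

  closedWalk : List (Fin n) → C1
  closedWalk [] = zeroC
  closedWalk (a ∷ rest) = walkFrom a (a ∷ rest)

-- Fix base vertices u₁ ∈ U and v₁ ∈ V, and for every vertex a path to it from the base vertex
-- of its side.  Closing each edge ij up with these paths turns a 1-cycle z into Σ z_ij ·
-- (loop through ij): the attached paths cancel because ∂z = 0.  A loop through an edge inside
-- U or inside V is a triangle of a clique, hence a boundary.  A loop through a cross edge xy is
-- the square (u₁,x,y,v₁); sliding it along G′ across the triangles xyy′ and x′xy (which exist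
-- because U and V are cliques) makes it homologous to the square of the representative edge of
-- its component, i.e. to one of the classes (u₁,u_i,v_i,v₁), or to 0 for the first component.
-- For independence, let χ indicate the i-th component and s indicate V; the 1-cochain
-- φ(a,b) = χ(a)(s(b) − s(a)) is a cocycle, so it vanishes on boundaries, and for i ≥ 2 its
-- value on the j-th square is δ_ij.

module Submission where

open import Defs
open import Level using (Level; _⊔_)
open import Algebra.Bundles using (CommutativeRing; CommutativeMonoid)
open import Algebra.Solver.Ring.AlmostCommutativeRing using (fromCommutativeRing; _-Raw-AlmostCommutative⟶_)
open import Data.Bool using (Bool; true; false; not; _∧_)
import Data.Bool.Properties as Bool
open import Data.Empty using (⊥-elim)
open import Data.Fin as Fin using (Fin; zero; suc; toℕ)
import Data.Fin.Properties as Fin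
open import Data.Integer as ℤ using (ℤ; +_; -[1+_]; _⊖_)
import Data.Integer.Properties as ℤ
open import Data.Integer.Base using (+-*-rawRing)
open import Data.List using (_∷_; [])
open import Data.Maybe using (Maybe; just; nothing)
open import Data.Nat as ℕ using (ℕ; zero; suc; _≡ᵇ_; _∸_)
import Data.Nat.Properties as ℕ
open import Data.Product using (Σ; _×_; _,_; proj₁; proj₂; uncurry)
open import Data.Sum using (_⊎_; inj₁; inj₂)
open import Function using (_∘_; Equivalence)
open import Relation.Binary.Construct.Closure.ReflexiveTransitive using (ε; _◅_; _◅◅_; reverse)
open import Relation.Binary.Definitions using (tri<; tri≈; tri>)
open import Relation.Binary.PropositionalEquality as ≡ using (_≡_; _≢_)
open import Relation.Nullary using (¬_; Dec; yes; no; ¬?)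
open import Relation.Nullary.Decidable using (_×-dec_)
open import Relation.Nullary.Reflects using (Reflects; ofʸ; ofⁿ; fromEquivalence)

-- A field has no decidable equality, so the ring solver is run with integer coefficients,
-- interpreted along the canonical map ℤ → R.
module IntegerCoefficients {c ℓ : Level} (R : CommutativeRing c ℓ) where
  open CommutativeRing R
  open import Algebra.Properties.Semiring.Mult semiring using (×-homo-+; ×1-homo-*)
    renaming (_×_ to _·1#×_)
  open import Algebra.Properties.Ring ring
    using (-0#≈0#; -‿involutive; -‿+-comm; -‿distribˡ-*; -‿distribʳ-*)
  open import Relation.Binary.Reasoning.Setoid setoid

  fromℤ : ℤ → Carrier
  fromℤ (+ k)    = k ·1#× 1#
  fromℤ -[1+ k ] = - (suc k ·1#× 1#)

  fromℤ-neg : ∀ i → fromℤ (ℤ.- i) ≈ - fromℤ i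
  fromℤ-neg (+ zero)  = sym -0#≈0#
  fromℤ-neg (+ suc k) = refl
  fromℤ-neg -[1+ k ]  = sym (-‿involutive _)

  +-cancel-common : ∀ a b d → (d + a) - (d + b) ≈ a - b
  +-cancel-common a b d = begin
    (d + a) - (d + b)       ≈⟨ +-congˡ (-‿+-comm d b) ⟨
    (d + a) + (- d + - b)   ≈⟨ +-assoc d a _ ⟩
    d + (a + (- d + - b))   ≈⟨ +-congˡ (+-assoc a (- d) (- b)) ⟨
    d + ((a + - d) + - b)   ≈⟨ +-congˡ (+-congʳ (+-comm a (- d))) ⟩
    d + ((- d + a) + - b)   ≈⟨ +-congˡ (+-assoc (- d) a (- b)) ⟩
    d + (- d + (a - b))     ≈⟨ +-assoc d (- d) _ ⟨
    (d + - d) + (a - b)     ≈⟨ +-congʳ (-‿inverseʳ d) ⟩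
    0# + (a - b)            ≈⟨ +-identityˡ _ ⟩
    a - b                   ∎

  fromℤ-⊖ : ∀ m k → fromℤ (m ⊖ k) ≈ m ·1#× 1# - k ·1#× 1#
  fromℤ-⊖ m       zero    = sym (trans (+-congˡ -0#≈0#) (+-identityʳ _))
  fromℤ-⊖ zero    (suc k) = sym (+-identityˡ _)
  fromℤ-⊖ (suc m) (suc k) rewrite ℤ.[1+m]⊖[1+n]≡m⊖n m k =
    trans (fromℤ-⊖ m k) (sym (+-cancel-common _ _ 1#))

  fromℤ-+ : ∀ i j → fromℤ (i ℤ.+ j) ≈ fromℤ i + fromℤ j
  fromℤ-+ (+ m)    (+ k)    = ×-homo-+ 1# m k
  fromℤ-+ (+ m)    -[1+ k ] = fromℤ-⊖ m (suc k)
  fromℤ-+ -[1+ m ] (+ k)    = trans (fromℤ-⊖ k (suc m)) (+-comm _ _)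
  fromℤ-+ -[1+ m ] -[1+ k ] = begin
    - (suc (suc (m ℕ.+ k)) ·1#× 1#)     ≡⟨ ≡.cong (λ j → - (suc j ·1#× 1#)) (ℕ.+-suc m k) ⟨
    - (suc m ℕ.+ suc k) ·1#× 1#         ≈⟨ -‿cong (×-homo-+ 1# (suc m) (suc k)) ⟩
    - (suc m ·1#× 1# + suc k ·1#× 1#)   ≈⟨ -‿+-comm _ _ ⟨
    fromℤ -[1+ m ] + fromℤ -[1+ k ]     ∎

  fromℤ-* : ∀ i j → fromℤ (i ℤ.* j) ≈ fromℤ i * fromℤ j
  fromℤ-* (+ m) (+ k) rewrite ℤ.+◃n≡+n (m ℕ.* k) = ×1-homo-* m k
  fromℤ-* (+ m) -[1+ k ] rewrite ℤ.-◃n≡-n (m ℕ.* suc k) =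
    trans (fromℤ-neg (+ (m ℕ.* suc k))) (trans (-‿cong (×1-homo-* m (suc k))) (-‿distribʳ-* _ _))
  fromℤ-* -[1+ m ] (+ k) rewrite ℤ.-◃n≡-n (suc m ℕ.* k) =
    trans (fromℤ-neg (+ (suc m ℕ.* k))) (trans (-‿cong (×1-homo-* (suc m) k)) (-‿distribˡ-* _ _))
  fromℤ-* -[1+ m ] -[1+ k ] rewrite ℤ.+◃n≡+n (suc m ℕ.* suc k) =
    trans (×1-homo-* (suc m) (suc k))
          (trans (sym (-‿involutive _)) (trans (-‿cong (-‿distribˡ-* _ _)) (-‿distribʳ-* _ _)))

  fromℤ-homomorphism : +-*-rawRing -Raw-AlmostCommutative⟶ fromCommutativeRing R
  fromℤ-homomorphism = record
    { ⟦_⟧    = fromℤ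
    ; +-homo = fromℤ-+
    ; *-homo = fromℤ-*
    ; -‿homo = fromℤ-neg
    ; 0-homo = refl
    ; 1-homo = +-identityʳ 1#
    }

  fromℤ-≟ : ∀ i j → Maybe (fromℤ i ≈ fromℤ j)
  fromℤ-≟ i j with i ℤ.≟ j
  ... | yes ≡.refl = just refl
  ... | no _       = nothing

  open import Algebra.Solver.Ring +-*-rawRing (fromCommutativeRing R) fromℤ-homomorphism fromℤ-≟
    public

module FlagComplex {c ℓ : Level} (F : Field c ℓ) {n : ℕ} (G : Graph n) where
  open Field F hiding (zero)
  open Graph G
  open Homology F G
  open IntegerCoefficients commRing using (solve; _:=_; _:+_; _:*_; :-_; _:-_; con)
  open import Algebra.Properties.Ring ring
    using (-0#≈0#; -‿involutive; -‿+-comm; -‿distribˡ-*; x[y-z]≈xy-xz; [y-z]x≈yx-zx; -1*x≈-x)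
  open import Algebra.Properties.CommutativeSemigroup +-commutativeSemigroup
    using () renaming (interchange to +-interchange)
  open import Algebra.Properties.CommutativeSemigroup
    (CommutativeMonoid.commutativeSemigroup Bool.∧-commutativeMonoid)
    using () renaming (x∙yz≈y∙xz to ∧-x∙yz≈y∙xz; x∙yz≈z∙xy to ∧-x∙yz≈z∙xy)
  open import Relation.Binary.Reasoning.Setoid setoid

  x-0≈x : ∀ x → x - 0# ≈ x
  x-0≈x x = trans (+-congˡ -0#≈0#) (+-identityʳ x)

  sum-cong : ∀ {m} {f g : Fin m → Carrier} → (∀ k → f k ≈ g k) → sumF f ≈ sumF g
  sum-cong {zero}  f≈g = refl
  sum-cong {suc m} f≈g = +-cong (f≈g zero) (sum-cong (f≈g ∘ suc))

  sum-0 : ∀ {m} → sumF {m} (λ _ → 0#) ≈ 0#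
  sum-0 {zero}  = refl
  sum-0 {suc m} = trans (+-identityˡ _) (sum-0 {m})

  sum-zero : ∀ {m} {f : Fin m → Carrier} → (∀ k → f k ≈ 0#) → sumF f ≈ 0#
  sum-zero {m} f≈0 = trans (sum-cong f≈0) (sum-0 {m})

  sum-+ : ∀ {m} (f g : Fin m → Carrier) → sumF (λ k → f k + g k) ≈ sumF f + sumF g
  sum-+ {zero}  f g = sym (+-identityʳ 0#)
  sum-+ {suc m} f g = trans (+-congˡ (sum-+ (f ∘ suc) (g ∘ suc))) (+-interchange _ _ _ _)

  sum-neg : ∀ {m} (f : Fin m → Carrier) → sumF (λ k → - f k) ≈ - sumF f
  sum-neg {zero}  f = sym -0#≈0#
  sum-neg {suc m} f = trans (+-congˡ (sum-neg (f ∘ suc))) (-‿+-comm _ _)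

  sum-- : ∀ {m} (f g : Fin m → Carrier) → sumF (λ k → f k - g k) ≈ sumF f - sumF g
  sum-- f g = trans (sum-+ f (λ k → - g k)) (+-congˡ (sum-neg g))

  sum-*ˡ : ∀ {m} a (f : Fin m → Carrier) → sumF (λ k → a * f k) ≈ a * sumF f
  sum-*ˡ {zero}  a f = sym (zeroʳ a)
  sum-*ˡ {suc m} a f = trans (+-congˡ (sum-*ˡ a (f ∘ suc))) (sym (distribˡ a _ _))

  sum-*ʳ : ∀ {m} a (f : Fin m → Carrier) → sumF (λ k → f k * a) ≈ sumF f * a
  sum-*ʳ a f = trans (sum-cong (λ k → *-comm (f k) a)) (trans (sum-*ˡ a f) (*-comm a _))

  sum-swap : ∀ {m m′} (f : Fin m → Fin m′ → Carrier) →
             sumF (λ i → sumF (λ j → f i j)) ≈ sumF (λ j → sumF (λ i → f i j))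
  sum-swap {zero}  {m′} f = sym (sum-0 {m′})
  sum-swap {suc m}      f = trans (+-congˡ (sum-swap (f ∘ suc))) (sym (sum-+ (f zero) _))

  sum-δ : ∀ {m} (a : Fin m) (f : Fin m → Carrier) → sumF (λ k → guard (toℕ k ≡ᵇ toℕ a) (f k)) ≈ f a
  sum-δ {suc m} zero    f = trans (+-congˡ (sum-0 {m})) (+-identityʳ _)
  sum-δ {suc m} (suc a) f = trans (+-identityˡ _) (sum-δ a (f ∘ suc))

  guard-cong : ∀ b {x y} → x ≈ y → guard b x ≈ guard b y
  guard-cong true  x≈y = x≈y
  guard-cong false x≈y = refl

  guard-when : ∀ b {x y} → (b ≡ true → x ≈ y) → guard b x ≈ guard b y
  guard-when true  x≈y = x≈y ≡.refl
  guard-when false x≈y = refl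

  guard-0 : ∀ b → guard b 0# ≈ 0#
  guard-0 true  = refl
  guard-0 false = refl

  guard-+ : ∀ b x y → guard b (x + y) ≈ guard b x + guard b y
  guard-+ true  x y = refl
  guard-+ false x y = sym (+-identityʳ 0#)

  guard-- : ∀ b x y → guard b (x - y) ≈ guard b x - guard b y
  guard-- true  x y = refl
  guard-- false x y = sym (x-0≈x 0#)

  guard-*ˡ : ∀ b a x → guard b (a * x) ≈ a * guard b x
  guard-*ˡ true  a x = refl
  guard-*ˡ false a x = sym (zeroʳ a)

  guard-*ʳ : ∀ b x y → guard b (x * y) ≈ guard b x * y
  guard-*ʳ true  x y = refl
  guard-*ʳ false x y = sym (zeroˡ y)

  guard-1-* : ∀ b x → guard b 1# * x ≈ guard b x
  guard-1-* true  x = *-identityˡ x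
  guard-1-* false x = zeroˡ x

  guard-sum : ∀ {m} b (f : Fin m → Carrier) → guard b (sumF f) ≈ sumF (λ k → guard b (f k))
  guard-sum      true  f = refl
  guard-sum {m} false f = sym (sum-0 {m})

  guard-∧ : ∀ b₁ b₂ x → guard (b₁ ∧ b₂) x ≡ guard b₁ (guard b₂ x)
  guard-∧ true  b₂ x = ≡.refl
  guard-∧ false b₂ x = ≡.refl

  guard-absorb : ∀ b₁ {b₂} x → (b₁ ≡ true → b₂ ≡ true) → guard b₂ (guard b₁ x) ≈ guard b₁ x
  guard-absorb false x _   = guard-0 _
  guard-absorb true  x b₂! rewrite b₂! ≡.refl = refl

  ∧-true : ∀ {b₁ b₂} → (b₁ ∧ b₂) ≡ true → b₁ ≡ true × b₂ ≡ true
  ∧-true {true} b₂! = ≡.refl , b₂!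

  eqv-reflects : ∀ {m} (i j : Fin m) → Reflects (i ≡ j) (toℕ i ≡ᵇ toℕ j)
  eqv-reflects i j =
    fromEquivalence (Fin.toℕ-injective ∘ ℕ.≡ᵇ⇒≡ _ _) (ℕ.≡⇒≡ᵇ _ _ ∘ ≡.cong toℕ)

  eqv-refl : ∀ {m} (i : Fin m) → (toℕ i ≡ᵇ toℕ i) ≡ true
  eqv-refl i with toℕ i ≡ᵇ toℕ i | eqv-reflects i i
  ... | true  | _       = ≡.refl
  ... | false | ofⁿ i≢i = ⊥-elim (i≢i ≡.refl)

  eqv-sym : ∀ i j → eqv i j ≡ eqv j i
  eqv-sym i j with eqv i j | eqv-reflects i j
  ... | true  | ofʸ ≡.refl = ≡.sym (eqv-refl i)
  ... | false | ofⁿ i≢j   with eqv j i | eqv-reflects j i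
  ...   | true  | ofʸ ≡.refl = ⊥-elim (i≢j ≡.refl)
  ...   | false | _          = ≡.refl

  eqv-true : ∀ {i j} → eqv i j ≡ true → i ≡ j
  eqv-true {i} {j} i=j with eqv i j | eqv-reflects i j
  ... | true | ofʸ i≡j = i≡j

  lt-true : ∀ {i j} → i Fin.< j → lt i j ≡ true
  lt-true i<j = Equivalence.to Bool.T-≡ (ℕ.<⇒<ᵇ i<j)

  lt-sound : ∀ {i j} → lt i j ≡ true → i Fin.< j
  lt-sound {i} {j} ltij = ℕ.<ᵇ⇒< (toℕ i) (toℕ j) (Equivalence.from Bool.T-≡ ltij)

  lt-trans : ∀ {i j k} → lt i j ≡ true → lt j k ≡ true → lt i k ≡ true
  lt-trans {i} {j} {k} ltij ltjk =
    lt-true {i} {k} (ℕ.<-trans (lt-sound {i} {j} ltij) (lt-sound {j} {k} ltjk))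

  lt-irrefl : ∀ {i j} → lt i j ≡ true → i ≢ j
  lt-irrefl {i} ltij ≡.refl = ℕ.<-irrefl ≡.refl (lt-sound {i} {i} ltij)

  lt-asym : ∀ {i j} → lt i j ≡ true → lt j i ≡ false
  lt-asym {i} {j} ltij with lt j i in ltji
  ... | true  = ⊥-elim (ℕ.<-asym (lt-sound {i} {j} ltij) (lt-sound {j} {i} ltji))
  ... | false = ≡.refl

  Edge-sym : ∀ {a b} → Edge a b → Edge b a
  Edge-sym {a} {b} e = ≡.trans (adj-sym b a) e

  Edge-irrefl : ∀ {a} → ¬ Edge a a
  Edge-irrefl {a} e with ≡.trans (≡.sym e) (adj-irrefl a)
  ... | ()

  record Linear {a} (A : Set a) (L : (A → Carrier) → Carrier) : Set (a ⊔ c ⊔ ℓ) where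
    field
      lin-cong : ∀ {f g} → (∀ x → f x ≈ g x) → L f ≈ L g
      lin-+    : ∀ f g → L (λ x → f x + g x) ≈ L f + L g
      lin-*    : ∀ s f → L (λ x → s * f x) ≈ s * L f

    lin-0 : L (λ _ → 0#) ≈ 0#
    lin-0 = begin
      L (λ _ → 0#)       ≈⟨ lin-cong (λ _ → sym (zeroˡ 0#)) ⟩
      L (λ _ → 0# * 0#)  ≈⟨ lin-* 0# (λ _ → 0#) ⟩
      0# * L (λ _ → 0#)  ≈⟨ zeroˡ _ ⟩
      0#                 ∎

    lin-neg : ∀ f → L (λ x → - f x) ≈ - L f
    lin-neg f = begin
      L (λ x → - f x)         ≈⟨ lin-cong (λ x → sym (-1*x≈-x (f x))) ⟩
      L (λ x → - 1# * f x)    ≈⟨ lin-* (- 1#) f ⟩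
      - 1# * L f              ≈⟨ -1*x≈-x _ ⟩
      - L f                   ∎

    lin-- : ∀ f g → L (λ x → f x - g x) ≈ L f - L g
    lin-- f g = trans (lin-+ f (λ x → - g x)) (+-congˡ (lin-neg g))

    lin-sum : ∀ {m} (f : Fin m → A → Carrier) → L (λ x → sumF (λ k → f k x)) ≈ sumF (λ k → L (f k))
    lin-sum {zero}  f = lin-0
    lin-sum {suc m} f = trans (lin-+ (f zero) _) (+-congˡ (lin-sum (f ∘ suc)))

  open Linear public

  module _ {a} {A : Set a} where

    linear-eval : (x : A) → Linear A (λ f → f x)
    linear-eval x = record { lin-cong = λ f≈g → f≈g x ; lin-+ = λ _ _ → refl ; lin-* = λ _ _ → refl }

    linear-guard : ∀ {L} b → Linear A L → Linear A (λ f → guard b (L f))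
    linear-guard b l = record
      { lin-cong = guard-cong b ∘ lin-cong l
      ; lin-+    = λ f g → trans (guard-cong b (lin-+ l f g)) (guard-+ b _ _)
      ; lin-*    = λ s f → trans (guard-cong b (lin-* l s f)) (guard-*ˡ b s _)
      }

    linear-scale : ∀ {L} s → Linear A L → Linear A (λ f → s * L f)
    linear-scale s l = record
      { lin-cong = *-congˡ ∘ lin-cong l
      ; lin-+    = λ f g → trans (*-congˡ (lin-+ l f g)) (distribˡ s _ _)
      ; lin-*    = λ t f → trans (*-congˡ (lin-* l t f)) (x*[y*z]≈y*[x*z] s t _)
      }
      where
      x*[y*z]≈y*[x*z] : ∀ x y z → x * (y * z) ≈ y * (x * z)
      x*[y*z]≈y*[x*z] = solve 3 (λ x y z → x :* (y :* z) := y :* (x :* z)) refl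

    linear-+ : ∀ {L₁ L₂} → Linear A L₁ → Linear A L₂ → Linear A (λ f → L₁ f + L₂ f)
    linear-+ l₁ l₂ = record
      { lin-cong = λ f≈g → +-cong (lin-cong l₁ f≈g) (lin-cong l₂ f≈g)
      ; lin-+    = λ f g → trans (+-cong (lin-+ l₁ f g) (lin-+ l₂ f g)) (+-interchange _ _ _ _)
      ; lin-*    = λ s f → trans (+-cong (lin-* l₁ s f) (lin-* l₂ s f)) (sym (distribˡ s _ _))
      }

    linear-- : ∀ {L₁ L₂} → Linear A L₁ → Linear A L₂ → Linear A (λ f → L₁ f - L₂ f)
    linear-- l₁ l₂ = record
      { lin-cong = λ f≈g → +-cong (lin-cong l₁ f≈g) (-‿cong (lin-cong l₂ f≈g))
      ; lin-+    = λ f g → trans (+-cong (lin-+ l₁ f g) (-‿cong (lin-+ l₂ f g))) (sub-interchange _ _ _ _)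
      ; lin-*    = λ s f → trans (+-cong (lin-* l₁ s f) (-‿cong (lin-* l₂ s f))) (sym (x[y-z]≈xy-xz s _ _))
      }
      where
      sub-interchange : ∀ a b x y → (a + b) - (x + y) ≈ (a - x) + (b - y)
      sub-interchange = solve 4 (λ a b x y → (a :+ b) :- (x :+ y) := (a :- x) :+ (b :- y)) refl

    linear-sum : ∀ {m} {L : Fin m → (A → Carrier) → Carrier} →
                 (∀ k → Linear A (L k)) → Linear A (λ f → sumF (λ k → L k f))
    linear-sum {zero}  ls = record
      { lin-cong = λ _ → refl ; lin-+ = λ _ _ → sym (+-identityʳ 0#) ; lin-* = λ s _ → sym (zeroʳ s) }
    linear-sum {suc m} ls = linear-+ (ls zero) (linear-sum (ls ∘ suc))

  -- Boundaries and homology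

  Triple : Set
  Triple = Fin n × Fin n × Fin n

  tripled : C2 → Triple → Carrier
  tripled t (a , b , c) = t a b c

  ∂₂-linear : ∀ i j → Linear Triple (λ t → ∂₂ (λ a b c → t (a , b , c)) i j)
  ∂₂-linear i j =
    linear-+ (linear-- (linear-sum λ k → linear-guard _ (linear-eval (k , i , j)))
                       (linear-sum λ k → linear-guard _ (linear-eval (i , k , j))))
             (linear-sum λ k → linear-guard _ (linear-eval (i , j , k)))

  ∂₂-0 : ∀ i j → ∂₂ (λ _ _ _ → 0#) i j ≈ 0#
  ∂₂-0 i j = lin-0 (∂₂-linear i j)

  ∂₂-+ : ∀ t₁ t₂ i j → ∂₂ (λ a b c → t₁ a b c + t₂ a b c) i j ≈ ∂₂ t₁ i j + ∂₂ t₂ i j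
  ∂₂-+ t₁ t₂ i j = lin-+ (∂₂-linear i j) (tripled t₁) (tripled t₂)

  ∂₂-neg : ∀ t i j → ∂₂ (λ a b c → - t a b c) i j ≈ - ∂₂ t i j
  ∂₂-neg t i j = lin-neg (∂₂-linear i j) (tripled t)

  ∂₂-* : ∀ s t i j → ∂₂ (λ a b c → s * t a b c) i j ≈ s * ∂₂ t i j
  ∂₂-* s t i j = lin-* (∂₂-linear i j) s (tripled t)

  negC : C1 → C1
  negC x a b = - x a b

  scaleC : Carrier → C1 → C1
  scaleC s x a b = s * x a b

  sumC : ∀ {m} → (Fin m → C1) → C1
  sumC x a b = sumF (λ k → x k a b)

  guardC : Bool → C1 → C1
  guardC β x a b = guard β (x a b)

  infix 4 _≐_
  _≐_ : C1 → C1 → Set ℓ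
  x ≐ y = ∀ a b → lt a b ≡ true → Edge a b → x a b ≈ y a b

  ≐-pointwise : ∀ {x y} → (∀ a b → x a b ≈ y a b) → x ≐ y
  ≐-pointwise x≈y a b _ _ = x≈y a b

  ≐-refl : ∀ {x} → x ≐ x
  ≐-refl _ _ _ _ = refl

  ≐-sym : ∀ {x y} → x ≐ y → y ≐ x
  ≐-sym x≐y a b a<b e = sym (x≐y a b a<b e)

  IsBoundary : C1 → Set (c ⊔ ℓ)
  IsBoundary x = Homologous x zeroC

  homologous-≐ : ∀ {x y} → x ≐ y → Homologous x y
  homologous-≐ x≐y = (λ _ _ _ → 0#) , λ i j i<j e →
    trans (x≐y i j i<j e) (sym (trans (+-congˡ (∂₂-0 i j)) (+-identityʳ _)))

  homologous-refl : ∀ x → Homologous x x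
  homologous-refl x = homologous-≐ {x} ≐-refl

  homologous-trans : ∀ {x y z} → Homologous x y → Homologous y z → Homologous x z
  homologous-trans (t₁ , h₁) (t₂ , h₂) = (λ a b c → t₁ a b c + t₂ a b c) , λ i j i<j e →
    trans (trans (h₁ i j i<j e) (trans (+-congʳ (h₂ i j i<j e)) (regroup _ _ _)))
          (+-congˡ (sym (∂₂-+ t₁ t₂ i j)))
    where
    regroup : ∀ z d₁ d₂ → (z + d₂) + d₁ ≈ z + (d₁ + d₂)
    regroup = solve 3 (λ z d₁ d₂ → (z :+ d₂) :+ d₁ := z :+ (d₁ :+ d₂)) refl

  homologous-+ : ∀ {x x′ y y′} → Homologous x x′ → Homologous y y′ → Homologous (x +C y) (x′ +C y′)
  homologous-+ (t₁ , h₁) (t₂ , h₂) = (λ a b c → t₁ a b c + t₂ a b c) , λ i j i<j e →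
    trans (trans (+-cong (h₁ i j i<j e) (h₂ i j i<j e)) (+-interchange _ _ _ _))
          (+-congˡ (sym (∂₂-+ t₁ t₂ i j)))

  homologous-scale : ∀ s {x y} → Homologous x y → Homologous (scaleC s x) (scaleC s y)
  homologous-scale s (t , h) = (λ a b c → s * t a b c) , λ i j i<j e →
    trans (*-congˡ (h i j i<j e)) (trans (distribˡ s _ _) (+-congˡ (sym (∂₂-* s t i j))))

  homologous-neg : ∀ {x y} → Homologous x y → Homologous (negC x) (negC y)
  homologous-neg (t , h) = (λ a b c → - t a b c) , λ i j i<j e →
    trans (-‿cong (h i j i<j e)) (trans (sym (-‿+-comm _ _)) (+-congˡ (sym (∂₂-neg t i j))))

  homologous-resp : ∀ {x x′ y y′} → x ≐ x′ → y ≐ y′ → Homologous x′ y′ → Homologous x y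
  homologous-resp {y = y} {y′} x≐x′ y≐y′ h =
    homologous-trans (homologous-≐ x≐x′) (homologous-trans h (homologous-≐ {y′} {y} (≐-sym y≐y′)))

  boundary-resp : ∀ {x y} → x ≐ y → IsBoundary y → IsBoundary x
  boundary-resp x≐y = homologous-resp x≐y ≐-refl

  boundary-neg : ∀ {x} → IsBoundary x → IsBoundary (negC x)
  boundary-neg h = homologous-resp ≐-refl (λ _ _ _ _ → sym -0#≈0#) (homologous-neg h)

  boundary-+ : ∀ {x y} → IsBoundary x → IsBoundary y → IsBoundary (x +C y)
  boundary-+ x~0 y~0 = homologous-resp ≐-refl (λ _ _ _ _ → sym (+-identityʳ 0#)) (homologous-+ x~0 y~0)

  homologous-+boundary : ∀ {x b} → IsBoundary b → Homologous (x +C b) x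
  homologous-+boundary {x} b~0 =
    homologous-resp ≐-refl (λ _ _ _ _ → sym (+-identityʳ _)) (homologous-+ (homologous-refl x) b~0)

  -- Triangles of X(G) are boundaries

  elementary : Fin n → Fin n → C1
  elementary a b i j = guard (eqv i a ∧ eqv j b) 1#

  elementary-reversed : ∀ a b i j → lt i j ≡ true → lt b a ≡ true → elementary a b i j ≈ 0#
  elementary-reversed a b i j ltij ltba with eqv i a in i=a | eqv j b in j=b
  ... | false | _     = refl
  ... | true  | false = refl
  ... | true  | true  with eqv-true {i} i=a | eqv-true {j} j=b
  ...   | ≡.refl | ≡.refl with ≡.trans (≡.sym ltij) (lt-asym {b} ltba)
  ...     | ()

  orientedEdge-anti : ∀ a b i j → orientedEdge b a i j ≈ - orientedEdge a b i j
  orientedEdge-anti a b i j = y-x≈-[x-y] (elementary b a i j) (elementary a b i j)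
    where
    y-x≈-[x-y] : ∀ y x → y - x ≈ - (x - y)
    y-x≈-[x-y] = solve 2 (λ y x → y :- x := :- (x :- y)) refl

  orientedEdge-self : ∀ a i j → orientedEdge a a i j ≈ 0#
  orientedEdge-self a i j = -‿inverseʳ _

  loop₃ : Fin n → Fin n → Fin n → C1
  loop₃ a b c = closedWalk (a ∷ b ∷ c ∷ [])

  loop₃-rotate : ∀ a b c → loop₃ a b c ≐ loop₃ b c a
  loop₃-rotate a b c = ≐-pointwise λ i j →
    rotate (orientedEdge a b i j) (orientedEdge b c i j) (orientedEdge c a i j)
    where
    rotate : ∀ x y z → x + (y + z) ≈ y + (z + x)
    rotate = solve 3 (λ x y z → x :+ (y :+ z) := y :+ (z :+ x)) refl

  loop₃-flip : ∀ a b c → loop₃ b a c ≐ negC (loop₃ a b c)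
  loop₃-flip a b c = ≐-pointwise λ i j → begin
    orientedEdge b a i j + (orientedEdge a c i j + orientedEdge c b i j)
      ≈⟨ +-cong (orientedEdge-anti a b i j) (+-cong (orientedEdge-anti c a i j) (orientedEdge-anti b c i j)) ⟩
    - orientedEdge a b i j + (- orientedEdge c a i j + - orientedEdge b c i j)
      ≈⟨ flip (orientedEdge a b i j) (orientedEdge b c i j) (orientedEdge c a i j) ⟩
    negC (loop₃ a b c) i j ∎
    where
    flip : ∀ x y z → - x + (- z + - y) ≈ - (x + (y + z))
    flip = solve 3 (λ x y z → :- x :+ (:- z :+ :- y) := :- (x :+ (y :+ z))) refl

  loop₃-degenerate : ∀ a c → loop₃ a a c ≐ zeroC
  loop₃-degenerate a c = ≐-pointwise λ i j → begin
    orientedEdge a a i j + (orientedEdge a c i j + orientedEdge c a i j)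
      ≈⟨ +-cong (orientedEdge-self a i j) (+-congˡ (orientedEdge-anti a c i j)) ⟩
    0# + (orientedEdge a c i j - orientedEdge a c i j)
      ≈⟨ trans (+-identityˡ _) (-‿inverseʳ _) ⟩
    0# ∎

  simplex : Fin n → Fin n → Fin n → C2
  simplex a b c i j k = guard (eqv i a ∧ (eqv j b ∧ eqv k c)) 1#

  simplex-support : ∀ {a b c} i j k → (eqv i a ∧ (eqv j b ∧ eqv k c)) ≡ true → i ≡ a × j ≡ b × k ≡ c
  simplex-support i j k s≠0 with ∧-true s≠0
  ... | i=a , j=b∧k=c with ∧-true j=b∧k=c
  ...   | j=b , k=c = eqv-true {i} i=a , eqv-true {j} j=b , eqv-true {k} k=c

  sum-over-face : ∀ (onFace : Fin n → Bool) (shape : Fin n → Bool) v rest →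
                  (∀ k → shape k ≡ (eqv k v ∧ rest)) → (∀ k → shape k ≡ true → onFace k ≡ true) →
                  sumF (λ k → guard (onFace k) (guard (shape k) 1#)) ≈ guard rest 1#
  sum-over-face onFace shape v rest shape≡ support = begin
    sumF (λ k → guard (onFace k) (guard (shape k) 1#))  ≈⟨ sum-cong (λ k → guard-absorb (shape k) 1# (support k)) ⟩
    sumF (λ k → guard (shape k) 1#)                     ≈⟨ sum-cong (λ k → reflexive (split k)) ⟩
    sumF (λ k → guard (eqv k v) (guard rest 1#))        ≈⟨ sum-δ v _ ⟩
    guard rest 1#                                       ∎
    where
    split : ∀ k → guard (shape k) 1# ≡ guard (eqv k v) (guard rest 1#)
    split k = ≡.trans (≡.cong (λ β → guard β 1#) (shape≡ k)) (guard-∧ (eqv k v) rest 1#)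

  module SortedTriangle {a b c} (ab : lt a b ≡ true) (bc : lt b c ≡ true) (abc : tri a b c ≡ true) where

    ∂₂-simplex : ∀ i j → ∂₂ (simplex a b c) i j ≈ (elementary b c i j - elementary a c i j) + elementary a b i j
    ∂₂-simplex i j = +-cong (+-cong (sum-over-face _ _ a _ (λ _ → ≡.refl) on₁) (-‿cong (sum-over-face _ _ b _ shape₂ on₂)))
                      (sum-over-face _ _ c _ shape₃ on₃)
      where
      shape₂ : ∀ k → (eqv i a ∧ (eqv k b ∧ eqv j c)) ≡ (eqv k b ∧ (eqv i a ∧ eqv j c))
      shape₂ k = ∧-x∙yz≈y∙xz (eqv i a) (eqv k b) (eqv j c)
      shape₃ : ∀ k → (eqv i a ∧ (eqv j b ∧ eqv k c)) ≡ (eqv k c ∧ (eqv i a ∧ eqv j b))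
      shape₃ k = ∧-x∙yz≈z∙xy (eqv i a) (eqv j b) (eqv k c)
      on₁ : ∀ k → (eqv k a ∧ (eqv i b ∧ eqv j c)) ≡ true → (lt k i ∧ tri k i j) ≡ true
      on₁ k s≠0 with simplex-support k i j s≠0
      ... | ≡.refl , ≡.refl , ≡.refl = ≡.cong₂ _∧_ ab abc
      on₂ : ∀ k → (eqv i a ∧ (eqv k b ∧ eqv j c)) ≡ true → (lt i k ∧ lt k j ∧ tri i k j) ≡ true
      on₂ k s≠0 with simplex-support i k j s≠0
      ... | ≡.refl , ≡.refl , ≡.refl = ≡.cong₂ _∧_ ab (≡.cong₂ _∧_ bc abc)
      on₃ : ∀ k → (eqv i a ∧ (eqv j b ∧ eqv k c)) ≡ true → (lt j k ∧ tri i j k) ≡ true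
      on₃ k s≠0 with simplex-support i j k s≠0
      ... | ≡.refl , ≡.refl , ≡.refl = ≡.cong₂ _∧_ bc abc

    loop₃≈∂₂-simplex : ∀ i j → lt i j ≡ true → loop₃ a b c i j ≈ 0# + ∂₂ (simplex a b c) i j
    loop₃≈∂₂-simplex i j ij = begin
      loop₃ a b c i j
        ≈⟨ +-cong (+-congˡ (-‿cong (elementary-reversed b a i j ij ab)))
                  (+-cong (+-congˡ (-‿cong (elementary-reversed c b i j ij bc)))
                          (+-congʳ (elementary-reversed c a i j ij (lt-trans {a} {b} {c} ab bc)))) ⟩
      (B a b - 0#) + ((B b c - 0#) + (0# - B a c))
        ≈⟨ drop-zeros (B a b) (B b c) (B a c) ⟩
      (B b c - B a c) + B a b
        ≈⟨ ∂₂-simplex i j ⟨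
      ∂₂ (simplex a b c) i j
        ≈⟨ +-identityˡ _ ⟨
      0# + ∂₂ (simplex a b c) i j ∎
      where
      B : Fin n → Fin n → Carrier
      B x y = elementary x y i j
      drop-zeros : ∀ p q r → (p - 0#) + ((q - 0#) + (0# - r)) ≈ (q - r) + p
      drop-zeros = solve 3 (λ p q r → (p :- con (+ 0)) :+ ((q :- con (+ 0)) :+ (con (+ 0) :- r))
                                      := (q :- r) :+ p) refl

    loop₃-boundary : IsBoundary (loop₃ a b c)
    loop₃-boundary = simplex a b c , λ i j ij _ → loop₃≈∂₂-simplex i j ij

  AdjOrEq : Fin n → Fin n → Set
  AdjOrEq x y = x ≡ y ⊎ Edge x y

  adjOrEq-sym : ∀ {x y} → AdjOrEq x y → AdjOrEq y x
  adjOrEq-sym (inj₁ x≡y) = inj₁ (≡.sym x≡y)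
  adjOrEq-sym (inj₂ e)   = inj₂ (Edge-sym e)

  adjOrEq-edge : ∀ {x y} → AdjOrEq x y → x ≢ y → Edge x y
  adjOrEq-edge (inj₁ x≡y) x≢y = ⊥-elim (x≢y x≡y)
  adjOrEq-edge (inj₂ e)   _   = e

  private
    boundary-rotate : ∀ a b c → IsBoundary (loop₃ b c a) → IsBoundary (loop₃ a b c)
    boundary-rotate a b c = boundary-resp (loop₃-rotate a b c)

    boundary-rotate² : ∀ a b c → IsBoundary (loop₃ c a b) → IsBoundary (loop₃ a b c)
    boundary-rotate² a b c = boundary-rotate a b c ∘ boundary-rotate b c a

    boundary-flip : ∀ a b c → IsBoundary (loop₃ b a c) → IsBoundary (loop₃ a b c)
    boundary-flip a b c h = boundary-resp (loop₃-flip b a c) (boundary-neg h)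

    boundary-degenerate : ∀ a c → IsBoundary (loop₃ a a c)
    boundary-degenerate a c = boundary-resp (loop₃-degenerate a c) (homologous-refl zeroC)

    boundary-sorted : ∀ {a b c} → lt a b ≡ true → lt b c ≡ true →
                      AdjOrEq a b → AdjOrEq b c → AdjOrEq a c → IsBoundary (loop₃ a b c)
    boundary-sorted {a} {b} {c} ab bc a~b b~c a~c =
      SortedTriangle.loop₃-boundary ab bc (≡.cong₂ _∧_ eab (≡.cong₂ _∧_ ebc eac))
      where
      eab : Edge a b
      eab = adjOrEq-edge a~b (lt-irrefl {a} ab)
      ebc : Edge b c
      ebc = adjOrEq-edge b~c (lt-irrefl {b} bc)
      eac : Edge a c
      eac = adjOrEq-edge a~c (lt-irrefl {a} (lt-trans {a} {b} {c} ab bc))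

    boundary-lt : ∀ {a b c} → lt a b ≡ true →
                  AdjOrEq a b → AdjOrEq b c → AdjOrEq a c → IsBoundary (loop₃ a b c)
    boundary-lt {a} {b} {c} ab a~b b~c a~c with Fin.<-cmp b c
    ... | tri< b<c _ _ = boundary-sorted ab (lt-true {b} {c} b<c) a~b b~c a~c
    ... | tri≈ _ ≡.refl _ = boundary-rotate a b b (boundary-degenerate b a)
    ... | tri> _ _ c<b with Fin.<-cmp a c
    ...   | tri< a<c _ _ = boundary-rotate² a b c (boundary-flip c a b
              (boundary-sorted (lt-true {a} {c} a<c) (lt-true {c} {b} c<b) a~c (adjOrEq-sym b~c) a~b))
    ...   | tri≈ _ ≡.refl _ = boundary-rotate² a b a (boundary-degenerate a b)
    ...   | tri> _ _ c<a = boundary-rotate² a b c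
              (boundary-sorted (lt-true {c} {a} c<a) ab (adjOrEq-sym a~c) a~b (adjOrEq-sym b~c))

  loop₃-boundary : ∀ {a b c} → AdjOrEq a b → AdjOrEq b c → AdjOrEq a c → IsBoundary (loop₃ a b c)
  loop₃-boundary {a} {b} {c} a~b b~c a~c with Fin.<-cmp a b
  ... | tri< a<b _ _ = boundary-lt (lt-true {a} {b} a<b) a~b b~c a~c
  ... | tri≈ _ ≡.refl _ = boundary-degenerate a c
  ... | tri> _ _ b<a = boundary-flip a b c (boundary-lt (lt-true {b} {a} b<a) (adjOrEq-sym a~b) a~c b~c)

  -- Pairing of 1-cochains with 1-chains

  ⟨_,_⟩ : C1 → C1 → Carrier
  ⟨ x , y ⟩ = sumF λ i → sumF λ j → guard (lt i j ∧ adj i j) (x i j * y i j)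

  pair-linear : ∀ x → Linear (Fin n × Fin n) (λ y → ⟨ x , (λ i j → y (i , j)) ⟩)
  pair-linear x = linear-sum λ i → linear-sum λ j →
    linear-guard _ (linear-scale (x i j) (linear-eval (i , j)))

  pair-+ʳ : ∀ x y w → ⟨ x , y +C w ⟩ ≈ ⟨ x , y ⟩ + ⟨ x , w ⟩
  pair-+ʳ x y w = lin-+ (pair-linear x) (uncurry y) (uncurry w)

  pair-linComb : ∀ x {m} (a : Fin m → Carrier) γ → ⟨ x , linComb a γ ⟩ ≈ sumF (λ k → a k * ⟨ x , γ k ⟩)
  pair-linComb x a γ = trans (lin-sum (pair-linear x) (λ k → uncurry (scaleC (a k) (γ k))))
                             (sum-cong λ k → lin-* (pair-linear x) (a k) (uncurry (γ k)))

  pair-comm : ∀ x y → ⟨ x , y ⟩ ≈ ⟨ y , x ⟩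
  pair-comm x y = sum-cong {n} λ i → sum-cong {n} λ j → guard-cong _ (*-comm (x i j) (y i j))

  pair-≐ : ∀ x {y y′} → y ≐ y′ → ⟨ x , y ⟩ ≈ ⟨ x , y′ ⟩
  pair-≐ x y≐y′ = sum-cong {n} λ i → sum-cong {n} λ j → guard-when (lt i j ∧ adj i j) λ ij! →
    *-congˡ (y≐y′ i j (proj₁ (∧-true ij!)) (proj₂ (∧-true ij!)))

  pair-elementary : ∀ x a b → ⟨ x , elementary a b ⟩ ≈ guard (lt a b ∧ adj a b) (x a b)
  pair-elementary x a b = begin
    ⟨ x , elementary a b ⟩                                 ≈⟨ sum-cong {n} (λ i → sum-cong {n} (pointwise i)) ⟩
    sumF (λ i → sumF (λ j → guard (eqv i a) (guard (eqv j b) xab)))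
                                                           ≈⟨ sum-cong {n} (λ i → sym (guard-sum {n} (eqv i a) _)) ⟩
    sumF (λ i → guard (eqv i a) (sumF (λ j → guard (eqv j b) xab)))
                                                           ≈⟨ sum-cong {n} (λ i → guard-cong (eqv i a) (sum-δ b _)) ⟩
    sumF (λ i → guard (eqv i a) xab)                       ≈⟨ sum-δ a _ ⟩
    xab                                                    ∎
    where
    xab : Carrier
    xab = guard (lt a b ∧ adj a b) (x a b)
    pointwise : ∀ i j → guard (lt i j ∧ adj i j) (x i j * elementary a b i j)
                      ≈ guard (eqv i a) (guard (eqv j b) xab)
    pointwise i j with eqv i a | eqv-reflects i a | eqv j b | eqv-reflects j b
    ... | true  | ofʸ ≡.refl | true  | ofʸ ≡.refl = guard-cong (lt i j ∧ adj i j) (*-identityʳ _)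
    ... | true  | ofʸ ≡.refl | false | _          = trans (guard-cong (lt i j ∧ adj i j) (zeroʳ _)) (guard-0 _)
    ... | false | _          | _     | _          = trans (guard-cong (lt i j ∧ adj i j) (zeroʳ _)) (guard-0 _)

  pair-orientedEdge : ∀ x a b →
    ⟨ x , orientedEdge a b ⟩ ≈ guard (lt a b ∧ adj a b) (x a b) - guard (lt b a ∧ adj b a) (x b a)
  pair-orientedEdge x a b =
    trans (lin-- (pair-linear x) (uncurry (elementary a b)) (uncurry (elementary b a)))
          (+-cong (pair-elementary x a b) (-‿cong (pair-elementary x b a)))

  pair-orientedEdge-sorted : ∀ x {a b} → lt a b ≡ true → Edge a b → ⟨ x , orientedEdge a b ⟩ ≈ x a b
  pair-orientedEdge-sorted x {a} {b} ab e with pair-orientedEdge x a b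
  ... | pairing rewrite ab | e | lt-asym {a} {b} ab = trans pairing (x-0≈x (x a b))

  Alternating : C1 → Set ℓ
  Alternating x = ∀ a b → Edge a b → x b a ≈ - x a b

  pair-orientedEdge-alternating : ∀ {x} → Alternating x → ∀ {a b} → Edge a b → ⟨ x , orientedEdge a b ⟩ ≈ x a b
  pair-orientedEdge-alternating {x} alt {a} {b} e with Fin.<-cmp a b
  ... | tri< a<b _ _ = pair-orientedEdge-sorted x (lt-true {a} {b} a<b) e
  ... | tri≈ _ ≡.refl _ = ⊥-elim (Edge-irrefl e)
  ... | tri> _ _ b<a with pair-orientedEdge x a b
  ...   | pairing rewrite lt-true {b} {a} b<a | Edge-sym e | lt-asym {b} {a} (lt-true {b} {a} b<a) = begin
    ⟨ x , orientedEdge a b ⟩  ≈⟨ pairing ⟩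
    0# - x b a                ≈⟨ +-identityˡ _ ⟩
    - x b a                   ≈⟨ -‿cong (alt a b e) ⟩
    - - x a b                 ≈⟨ -‿involutive _ ⟩
    x a b                     ∎

  loop₄ : Fin n → Fin n → Fin n → Fin n → C1
  loop₄ a b c d = closedWalk (a ∷ b ∷ c ∷ d ∷ [])

  pair-loop₄ : ∀ {x} → Alternating x → ∀ {a b c d} → Edge a b → Edge b c → Edge c d → Edge d a →
               ⟨ x , loop₄ a b c d ⟩ ≈ x a b + (x b c + (x c d + x d a))
  pair-loop₄ {x} alt {a} {b} {c} {d} ab bc cd da = begin
    ⟨ x , loop₄ a b c d ⟩
      ≈⟨ pair-+ʳ x _ _ ⟩
    ⟨ x , orientedEdge a b ⟩ + ⟨ x , orientedEdge b c +C (orientedEdge c d +C orientedEdge d a) ⟩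
      ≈⟨ +-congˡ (trans (pair-+ʳ x _ _) (+-congˡ (pair-+ʳ x _ _))) ⟩
    ⟨ x , orientedEdge a b ⟩ + (⟨ x , orientedEdge b c ⟩ + (⟨ x , orientedEdge c d ⟩ + ⟨ x , orientedEdge d a ⟩))
      ≈⟨ +-cong (edge ab) (+-cong (edge bc) (+-cong (edge cd) (edge da))) ⟩
    x a b + (x b c + (x c d + x d a)) ∎
    where
    edge : ∀ {a b} → Edge a b → ⟨ x , orientedEdge a b ⟩ ≈ x a b
    edge = pair-orientedEdge-alternating alt

  coboundary : (Fin n → Carrier) → C1
  coboundary f i j = f j - f i

  coboundary-alternating : ∀ f → Alternating (coboundary f)
  coboundary-alternating f a b _ = x-y≈-[y-x] (f a) (f b)
    where
    x-y≈-[y-x] : ∀ x y → x - y ≈ - (y - x)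
    x-y≈-[y-x] = solve 2 (λ x y → x :- y := :- (y :- x)) refl

  pair-coboundary : ∀ z f → ⟨ z , coboundary f ⟩ ≈ sumF (λ w → ∂₁ z w * f w)
  pair-coboundary z f = begin
    ⟨ z , coboundary f ⟩
      ≈⟨ sum-cong {n} (λ i → sum-cong {n} (λ j → trans (guard-cong (g i j) (x[y-z]≈xy-xz _ _ _)) (guard-- (g i j) _ _))) ⟩
    sumF (λ i → sumF (λ j → zf i j j - zf i j i))
      ≈⟨ trans (sum-cong {n} (λ i → sum-- {n} _ _)) (sum-- {n} _ _) ⟩
    sumF (λ i → sumF (λ j → zf i j j)) - sumF (λ i → sumF (λ j → zf i j i))
      ≈⟨ +-congʳ (sum-swap {n} (λ i j → zf i j j)) ⟩
    sumF (λ w → sumF (λ i → zf i w w)) - sumF (λ w → sumF (λ j → zf w j w))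
      ≈⟨ +-cong (sum-cong {n} (λ w → trans (sum-cong {n} (λ i → guard-*ʳ (g i w) _ _)) (sum-*ʳ {n} _ _)))
                (-‿cong (sum-cong {n} (λ w → trans (sum-cong {n} (λ j → guard-*ʳ (g w j) _ _)) (sum-*ʳ {n} _ _)))) ⟩
    sumF (λ w → into w * f w) - sumF (λ w → outof w * f w)
      ≈⟨ sum-- {n} _ _ ⟨
    sumF (λ w → into w * f w - outof w * f w)
      ≈⟨ sum-cong {n} (λ w → [y-z]x≈yx-zx (f w) _ _) ⟨
    sumF (λ w → ∂₁ z w * f w) ∎
    where
    g : Fin n → Fin n → Bool
    g i j = lt i j ∧ adj i j
    zf : Fin n → Fin n → Fin n → Carrier
    zf i j w = guard (g i j) (z i j * f w)
    into outof : Fin n → Carrier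
    into w  = sumF (λ i → guard (g i w) (z i w))
    outof w = sumF (λ j → guard (g w j) (z w j))

  cycle-pair-coboundary : ∀ {z} → IsCycle z → ∀ f → ⟨ z , coboundary f ⟩ ≈ 0#
  cycle-pair-coboundary {z} cyc f =
    trans (pair-coboundary z f) (sum-zero {n} λ w → trans (*-congʳ (cyc w)) (zeroˡ (f w)))

  indicator : ∀ {m} → Fin m → Fin m → Carrier
  indicator w v = guard (toℕ v ≡ᵇ toℕ w) 1#

  ∂₁-pairing : ∀ z w → ∂₁ z w ≈ ⟨ z , coboundary (indicator w) ⟩
  ∂₁-pairing z w = sym (begin
    ⟨ z , coboundary (indicator w) ⟩                   ≈⟨ pair-coboundary z (indicator w) ⟩
    sumF (λ v → ∂₁ z v * guard (eqv v w) 1#)           ≈⟨ sum-cong {n} (λ v → trans (*-comm _ _) (guard-1-* (eqv v w) _)) ⟩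
    sumF (λ v → guard (eqv v w) (∂₁ z v))              ≈⟨ sum-δ w (∂₁ z) ⟩
    ∂₁ z w                                             ∎)

  orientedEdge-transpose : ∀ a b i j → orientedEdge i j a b ≡ orientedEdge a b i j
  orientedEdge-transpose a b i j
    rewrite eqv-sym a i | eqv-sym b j | eqv-sym a j | eqv-sym b i | Bool.∧-comm (eqv j a) (eqv i b) = ≡.refl

  expand : C1 → (Fin n → Fin n → C1) → C1
  expand z χ = sumC λ i → sumC λ j → guardC (lt i j ∧ adj i j) (scaleC (z i j) (χ i j))

  ≐-expand-orientedEdges : ∀ z → z ≐ expand z orientedEdge
  ≐-expand-orientedEdges z a b ab e = sym (begin
    expand z orientedEdge a b
      ≈⟨ sum-cong {n} (λ i → sum-cong {n} (λ j →
           guard-cong (lt i j ∧ adj i j) (*-congˡ (reflexive (orientedEdge-transpose a b i j))))) ⟩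
    ⟨ z , orientedEdge a b ⟩
      ≈⟨ pair-orientedEdge-sorted z ab e ⟩
    z a b ∎)

  module _ {m} (γ : Fin m → C1) where

    Spanned : C1 → Set (c ⊔ ℓ)
    Spanned x = Σ (Fin m → Carrier) λ a → Homologous x (linComb a γ)

    spanned-homologous : ∀ {x y} → Homologous x y → Spanned y → Spanned x
    spanned-homologous x~y (a , y~γ) = a , homologous-trans x~y y~γ

    spanned-zero : Spanned zeroC
    spanned-zero = (λ _ → 0#) , homologous-≐ (≐-pointwise λ i j → sym (sum-zero λ k → zeroˡ (γ k i j)))

    spanned-boundary : ∀ {x} → IsBoundary x → Spanned x
    spanned-boundary x~0 = spanned-homologous x~0 spanned-zero

    spanned-+ : ∀ {x y} → Spanned x → Spanned y → Spanned (x +C y)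
    spanned-+ (a , x~) (b , y~) = (λ k → a k + b k) ,
      homologous-trans (homologous-+ x~ y~) (homologous-≐ (≐-pointwise λ i j →
        sym (trans (sum-cong (λ k → distribʳ (γ k i j) (a k) (b k))) (sum-+ {m} _ _))))

    spanned-scale : ∀ s {x} → Spanned x → Spanned (scaleC s x)
    spanned-scale s (a , x~) = (λ k → s * a k) ,
      homologous-trans (homologous-scale s x~) (homologous-≐ (≐-pointwise λ i j →
        sym (trans (sum-cong (λ k → *-assoc s (a k) (γ k i j))) (sum-*ˡ {m} s _))))

    spanned-sum : ∀ {k} {x : Fin k → C1} → (∀ l → Spanned (x l)) → Spanned (sumC x)
    spanned-sum {zero}  _       = spanned-zero
    spanned-sum {suc k} spanned = spanned-+ (spanned zero) (spanned-sum (spanned ∘ suc))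

    spanned-guard : ∀ β {x} → (β ≡ true → Spanned x) → Spanned (guardC β x)
    spanned-guard true  spanned = spanned ≡.refl
    spanned-guard false _       = spanned-zero

    spanned-expand : ∀ z {χ} → (∀ i j → lt i j ≡ true → Edge i j → Spanned (χ i j)) → Spanned (expand z χ)
    spanned-expand z spanned = spanned-sum λ i → spanned-sum λ j → spanned-guard (lt i j ∧ adj i j) λ ij! →
      spanned-scale (z i j) (spanned i j (proj₁ (∧-true ij!)) (proj₂ (∧-true ij!)))

    spanned-neg : ∀ {x} → Spanned x → Spanned (negC x)
    spanned-neg {x} spanned = spanned-homologous
      (homologous-≐ {negC x} {scaleC (- 1#) x} (≐-pointwise λ i j → sym (-1*x≈-x (x i j))))
      (spanned-scale (- 1#) spanned)

    spanned-generator : ∀ k → Spanned (γ k)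
    spanned-generator k = indicator k , homologous-≐ (≐-pointwise λ i j →
      sym (trans (sum-cong (λ l → guard-1-* (toℕ l ≡ᵇ toℕ k) (γ l i j))) (sum-δ k (λ l → γ l i j))))

  -- Cocycles vanish on boundaries

  IsCocycle : C1 → Set ℓ
  IsCocycle x = ∀ a b c → lt a b ≡ true → lt b c ≡ true → tri a b c ≡ true → (x b c - x a c) + x a b ≈ 0#

  onSimplex : C2 → Fin n → Fin n → Fin n → Carrier
  onSimplex t a b c = guard (lt a b ∧ (lt b c ∧ tri a b c)) (t a b c)

  Σ₃ : (Fin n → Fin n → Fin n → Carrier) → Carrier
  Σ₃ f = sumF λ a → sumF λ b → sumF λ c → f a b c

  private
    guard-*-guard : ∀ g h {k} x y → (g ∧ h) ≡ k → guard g (x * guard h y) ≈ x * guard k y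
    guard-*-guard true  h x y ≡.refl = refl
    guard-*-guard false h x y ≡.refl = sym (zeroʳ x)

    ∧-absorb : ∀ {g h} → (h ≡ true → g ≡ true) → (g ∧ h) ≡ h
    ∧-absorb {h = false} _   = Bool.∧-zeroʳ _
    ∧-absorb {h = true}  h⇒g rewrite h⇒g ≡.refl = ≡.refl

    ∧-dup₁ : ∀ A B C D E → ((B ∧ D) ∧ (A ∧ (C ∧ (D ∧ E)))) ≡ (A ∧ (B ∧ (C ∧ (D ∧ E))))
    ∧-dup₁ false false _     _     _ = ≡.refl
    ∧-dup₁ true  false _     _     _ = ≡.refl
    ∧-dup₁ false true  _     false _ = ≡.refl
    ∧-dup₁ true  true  false false _ = ≡.refl
    ∧-dup₁ true  true  true  false _ = ≡.refl
    ∧-dup₁ _     true  _     true  _ = ≡.refl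

    ∧-dup₃ : ∀ A B C R → ((A ∧ C) ∧ (B ∧ (C ∧ R))) ≡ (A ∧ (B ∧ (C ∧ R)))
    ∧-dup₃ false _     _     _ = ≡.refl
    ∧-dup₃ true  false false _ = ≡.refl
    ∧-dup₃ true  true  false _ = ≡.refl
    ∧-dup₃ true  _     true  _ = ≡.refl

    guard-*-sum : ∀ g x (f : Fin n → Carrier) → guard g (x * sumF f) ≈ sumF (λ k → guard g (x * f k))
    guard-*-sum g x f = trans (guard-cong g (sym (sum-*ˡ x f))) (guard-sum {n} g _)

    module Faces (x : C1) (t : C2) where

      face₁ face₂ face₃ : C1
      face₁ i j = sumF (λ k → guard (lt k i ∧ tri k i j) (t k i j))
      face₂ i j = sumF (λ k → guard (lt i k ∧ lt k j ∧ tri i k j) (t i k j))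
      face₃ i j = sumF (λ k → guard (lt j k ∧ tri i j k) (t i j k))

      pair-face₁ : ⟨ x , face₁ ⟩ ≈ Σ₃ (λ a b c → x b c * onSimplex t a b c)
      pair-face₁ = begin
        ⟨ x , face₁ ⟩
          ≈⟨ sum-cong {n} (λ i → sum-cong {n} (λ j → trans (guard-*-sum _ _ _) (sum-cong {n} (λ k →
               guard-*-guard _ _ _ _ (∧-dup₁ (lt k i) (lt i j) (adj k i) (adj i j) (adj k j)))))) ⟩
        sumF (λ i → sumF (λ j → sumF (λ k → x i j * onSimplex t k i j)))
          ≈⟨ sum-cong {n} (λ i → sum-swap (λ j k → x i j * onSimplex t k i j)) ⟩
        sumF (λ i → sumF (λ k → sumF (λ j → x i j * onSimplex t k i j)))
          ≈⟨ sum-swap (λ i k → sumF (λ j → x i j * onSimplex t k i j)) ⟩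
        Σ₃ (λ a b c → x b c * onSimplex t a b c) ∎

      pair-face₂ : ⟨ x , face₂ ⟩ ≈ Σ₃ (λ a b c → x a c * onSimplex t a b c)
      pair-face₂ = begin
        ⟨ x , face₂ ⟩
          ≈⟨ sum-cong {n} (λ i → sum-cong {n} (λ j → trans (guard-*-sum _ _ _) (sum-cong {n} (λ k →
               guard-*-guard _ _ _ _ (∧-absorb (implied i j k)))))) ⟩
        sumF (λ i → sumF (λ j → sumF (λ k → x i j * onSimplex t i k j)))
          ≈⟨ sum-cong {n} (λ i → sum-swap (λ j k → x i j * onSimplex t i k j)) ⟩
        Σ₃ (λ a b c → x a c * onSimplex t a b c) ∎
        where
        implied : ∀ i j k → (lt i k ∧ lt k j ∧ tri i k j) ≡ true → (lt i j ∧ adj i j) ≡ true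
        implied i j k s with ∧-true s
        ... | ik , kj∧t with ∧-true kj∧t
        ...   | kj , t with ∧-true {adj i k} t
        ...     | _ , ikj = ≡.cong₂ _∧_ (lt-trans {i} {k} {j} ik kj) (proj₂ (∧-true {adj k j} ikj))

      pair-face₃ : ⟨ x , face₃ ⟩ ≈ Σ₃ (λ a b c → x a b * onSimplex t a b c)
      pair-face₃ = sum-cong {n} λ i → sum-cong {n} λ j → trans (guard-*-sum _ _ _) (sum-cong {n} λ k →
        guard-*-guard _ _ _ _ (∧-dup₃ (lt i j) (lt j k) (adj i j) (adj j k ∧ adj i k)))

  pair-∂₂ : ∀ x t → ⟨ x , ∂₂ t ⟩ ≈ Σ₃ (λ a b c → ((x b c - x a c) + x a b) * onSimplex t a b c)
  pair-∂₂ x t = begin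
    ⟨ x , ∂₂ t ⟩
      ≈⟨ lin-+ (pair-linear x) (λ q → uncurry face₁ q - uncurry face₂ q) (uncurry face₃) ⟩
    ⟨ x , (λ i j → face₁ i j - face₂ i j) ⟩ + ⟨ x , face₃ ⟩
      ≈⟨ +-congʳ (lin-- (pair-linear x) (uncurry face₁) (uncurry face₂)) ⟩
    (⟨ x , face₁ ⟩ - ⟨ x , face₂ ⟩) + ⟨ x , face₃ ⟩
      ≈⟨ +-cong (+-cong pair-face₁ (-‿cong pair-face₂)) pair-face₃ ⟩
    (Σ₃ (λ a b c → x b c * s a b c) - Σ₃ (λ a b c → x a c * s a b c)) + Σ₃ (λ a b c → x a b * s a b c)
      ≈⟨ +-congʳ (Σ₃-- _ _) ⟨
    Σ₃ (λ a b c → x b c * s a b c - x a c * s a b c) + Σ₃ (λ a b c → x a b * s a b c)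
      ≈⟨ Σ₃-+ _ _ ⟨
    Σ₃ (λ a b c → (x b c * s a b c - x a c * s a b c) + x a b * s a b c)
      ≈⟨ sum-cong {n} (λ a → sum-cong {n} (λ b → sum-cong {n} (λ c → factor (x b c) (x a c) (x a b) (s a b c)))) ⟩
    Σ₃ (λ a b c → ((x b c - x a c) + x a b) * s a b c) ∎
    where
    open Faces x t
    s : Fin n → Fin n → Fin n → Carrier
    s = onSimplex t
    Σ₃-+ : ∀ f g → Σ₃ (λ a b c → f a b c + g a b c) ≈ Σ₃ f + Σ₃ g
    Σ₃-+ f g = trans (sum-cong {n} λ a → trans (sum-cong {n} λ b → sum-+ {n} (f a b) (g a b)) (sum-+ {n} _ _))
                     (sum-+ {n} _ _)
    Σ₃-- : ∀ f g → Σ₃ (λ a b c → f a b c - g a b c) ≈ Σ₃ f - Σ₃ g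
    Σ₃-- f g = trans (sum-cong {n} λ a → trans (sum-cong {n} λ b → sum-- {n} (f a b) (g a b)) (sum-- {n} _ _))
                     (sum-- {n} _ _)
    factor : ∀ p q r u → (p * u - q * u) + r * u ≈ ((p - q) + r) * u
    factor = solve 4 (λ p q r u → (p :* u :- q :* u) :+ r :* u := ((p :- q) :+ r) :* u) refl

  cocycle-pair-∂₂ : ∀ {x} → IsCocycle x → ∀ t → ⟨ x , ∂₂ t ⟩ ≈ 0#
  cocycle-pair-∂₂ {x} cocycle t = trans (pair-∂₂ x t) (sum-zero {n} λ a → sum-zero {n} λ b → sum-zero {n} λ c →
    vanishes (lt a b ∧ (lt b c ∧ tri a b c)) (δx≈0 a b c))
    where
    vanishes : ∀ β {d y} → (β ≡ true → d ≈ 0#) → d * guard β y ≈ 0#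
    vanishes true  d≈0 = trans (*-congʳ (d≈0 ≡.refl)) (zeroˡ _)
    vanishes false _   = zeroʳ _
    δx≈0 : ∀ a b c → (lt a b ∧ (lt b c ∧ tri a b c)) ≡ true → (x b c - x a c) + x a b ≈ 0#
    δx≈0 a b c abc with ∧-true abc
    ... | ab , bc∧tr with ∧-true {lt b c} bc∧tr
    ...   | bc , tr = cocycle a b c ab bc tr

  cocycle-pair-homologous : ∀ {x} → IsCocycle x → ∀ {y w} → Homologous y w → ⟨ x , y ⟩ ≈ ⟨ x , w ⟩
  cocycle-pair-homologous {x} cocycle {y} {w} (t , y≈w+∂t) = begin
    ⟨ x , y ⟩                       ≈⟨ pair-≐ x y≈w+∂t ⟩
    ⟨ x , w +C ∂₂ t ⟩               ≈⟨ pair-+ʳ x w (∂₂ t) ⟩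
    ⟨ x , w ⟩ + ⟨ x , ∂₂ t ⟩        ≈⟨ +-congˡ (cocycle-pair-∂₂ cocycle t) ⟩
    ⟨ x , w ⟩ + 0#                  ≈⟨ +-identityʳ _ ⟩
    ⟨ x , w ⟩                       ∎

module TwoCliques {c ℓ : Level} (F : Field c ℓ) {n : ℕ} (G : Graph n) (inU : Fin n → Bool)
                  (cliques : GraphNotions.CliqueSides G inU) where
  open Field F hiding (zero)
  open Graph G
  open Homology F G
  open FlagComplex F G
  open IntegerCoefficients commRing using (solve; _:=_; _:+_; _:*_; :-_; _:-_; con)
  open import Relation.Binary.Reasoning.Setoid setoid

  side : ∀ x → inU x ≡ true ⊎ inU x ≡ false
  side x with inU x
  ... | true  = inj₁ ≡.refl
  ... | false = inj₂ ≡.refl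

  adjOrEq-sameSide : ∀ {x y} → inU x ≡ inU y → AdjOrEq x y
  adjOrEq-sameSide {x} {y} same with x Fin.≟ y
  ... | yes x≡y = inj₁ x≡y
  ... | no  x≢y = inj₂ (cliques x y x≢y same)

  true≢false : true ≢ false
  true≢false ()

  crossEdge-sym : ∀ {x y} → CrossEdge inU x y → CrossEdge inU y x
  crossEdge-sym (e , sides) = Edge-sym e , sides ∘ ≡.sym

  crossEdge : ∀ {x y} → inU x ≡ true → inU y ≡ false → Edge x y → CrossEdge inU x y
  crossEdge x∈U y∈V e = e , λ same → true≢false (≡.trans (≡.sym x∈U) (≡.trans same y∈V))

  adjOrEq-crossEdge : ∀ {x y} → AdjOrEq x y → inU x ≢ inU y → CrossEdge inU x y
  adjOrEq-crossEdge x~y sides = adjOrEq-edge x~y (λ { ≡.refl → sides ≡.refl }) , sides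

  crossEdge? : ∀ a b → Dec (CrossEdge inU a b)
  crossEdge? a b = (adj a b Bool.≟ true) ×-dec ¬? (inU a Bool.≟ inU b)

  crossEdge-to-V : ∀ {x y} → CrossEdge inU x y → inU x ≡ true → inU y ≡ false
  crossEdge-to-V {y = y} (_ , sides) x∈U with inU y
  ... | true  = ⊥-elim (sides (≡.trans x∈U ≡.refl))
  ... | false = ≡.refl

  crossEdge-to-U : ∀ {x y} → CrossEdge inU x y → inU x ≡ false → inU y ≡ true
  crossEdge-to-U {y = y} (_ , sides) x∈V with inU y
  ... | true  = ≡.refl
  ... | false = ⊥-elim (sides (≡.trans x∈V ≡.refl))

  private
    E : Fin n → Fin n → C1
    E = orientedEdge

  sameSide : ∀ {x y b} → inU x ≡ b → inU y ≡ b → inU x ≡ inU y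
  sameSide x∈ y∈ = ≡.trans x∈ (≡.sym y∈)

  module Potential (bU bV : Fin n) (bU∈U : ∀ x → inU x ≡ true → inU bU ≡ true)
                   (bV∈V : ∀ x → inU x ≡ false → inU bV ≡ false) where

    potential : Fin n → C1
    potential w = towards (inU w)
      where
      towards : Bool → C1
      towards true  = orientedEdge bU w
      towards false = orientedEdge bU bV +C orientedEdge bV w

    potential-U : ∀ {w} → inU w ≡ true → ∀ a b → potential w a b ≈ orientedEdge bU w a b
    potential-U w∈U a b rewrite w∈U = refl

    potential-V : ∀ {w} → inU w ≡ false → ∀ a b → potential w a b ≈ orientedEdge bU bV a b + orientedEdge bV w a b
    potential-V w∈V a b rewrite w∈V = refl

    closedUp : Fin n → Fin n → C1
    closedUp i j a b = potential i a b + (orientedEdge i j a b - potential j a b)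

    closedUp-UU : ∀ {i j} → inU i ≡ true → inU j ≡ true → closedUp i j ≐ loop₃ bU i j
    closedUp-UU {i} {j} i∈U j∈U = ≐-pointwise λ a b →
      trans (+-cong (potential-U i∈U a b) (+-congˡ (-‿cong (potential-U j∈U a b))))
            (+-congˡ (+-congˡ (sym (orientedEdge-anti bU j a b))))

    closedUp-VV : ∀ {i j} → inU i ≡ false → inU j ≡ false → closedUp i j ≐ loop₃ bV i j
    closedUp-VV {i} {j} i∈V j∈V = ≐-pointwise λ a b →
      trans (+-cong (potential-V i∈V a b) (+-congˡ (-‿cong (potential-V j∈V a b))))
            (trans (cancel (E bU bV a b) (E bV i a b) (E i j a b) (E bV j a b))
                   (+-congˡ (+-congˡ (sym (orientedEdge-anti bV j a b)))))
      where
      cancel : ∀ u p x r → (u + p) + (x - (u + r)) ≈ p + (x + - r)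
      cancel = solve 4 (λ u p x r → (u :+ p) :+ (x :- (u :+ r)) := p :+ (x :+ :- r)) refl

    closedUp-UV : ∀ {i j} → inU i ≡ true → inU j ≡ false → closedUp i j ≐ loop₄ bU i j bV
    closedUp-UV {i} {j} i∈U j∈V = ≐-pointwise λ a b →
      trans (+-cong (potential-U i∈U a b) (+-congˡ (-‿cong (potential-V j∈V a b))))
            (trans (regroup (E bU i a b) (E i j a b) (E bU bV a b) (E bV j a b))
                   (+-congˡ (+-congˡ (+-cong (sym (orientedEdge-anti bV j a b)) (sym (orientedEdge-anti bU bV a b))))))
      where
      regroup : ∀ p x u r → p + (x - (u + r)) ≈ p + (x + (- r + - u))
      regroup = solve 4 (λ p x u r → p :+ (x :- (u :+ r)) := p :+ (x :+ (:- r :+ :- u))) refl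

    closedUp-VU : ∀ {i j} → inU i ≡ false → inU j ≡ true → closedUp i j ≐ negC (loop₄ bU j i bV)
    closedUp-VU {i} {j} i∈V j∈U = ≐-pointwise λ a b →
      trans (+-cong (potential-V i∈V a b) (+-congˡ (-‿cong (potential-U j∈U a b))))
            (trans (regroup (E bU bV a b) (E bV i a b) (E i j a b) (E bU j a b))
                   (-‿cong (+-congˡ (+-cong (sym (orientedEdge-anti i j a b))
                                            (+-cong (sym (orientedEdge-anti bV i a b)) (sym (orientedEdge-anti bU bV a b)))))))
      where
      regroup : ∀ u p x r → (u + p) + (x - r) ≈ - (r + (- x + (- p + - u)))
      regroup = solve 4 (λ u p x r → (u :+ p) :+ (x :- r) := :- (r :+ (:- x :+ (:- p :+ :- u)))) refl

    -- The potentials telescope away against ∂₁ z = 0.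
    cycle-≐-expand-closedUp : ∀ {z} → IsCycle z → z ≐ expand z closedUp
    cycle-≐-expand-closedUp {z} cyc a b ab e = trans (≐-expand-orientedEdges z a b ab e) (begin
      ⟨ z , (λ i j → orientedEdge i j a b) ⟩
        ≈⟨ x-0≈x _ ⟨
      ⟨ z , (λ i j → orientedEdge i j a b) ⟩ - 0#
        ≈⟨ +-congˡ (-‿cong (cycle-pair-coboundary cyc (λ w → potential w a b))) ⟨
      ⟨ z , (λ i j → orientedEdge i j a b) ⟩ - ⟨ z , coboundary (λ w → potential w a b) ⟩
        ≈⟨ lin-- (pair-linear z) _ _ ⟨
      ⟨ z , (λ i j → orientedEdge i j a b - (potential j a b - potential i a b)) ⟩
        ≈⟨ lin-cong (pair-linear z) (λ (i , j) → regroup (potential i a b) (orientedEdge i j a b) (potential j a b)) ⟩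
      ⟨ z , (λ i j → closedUp i j a b) ⟩ ∎)
      where
      regroup : ∀ p x r → x - (r - p) ≈ p + (x - r)
      regroup = solve 3 (λ p x r → x :- (r :- p) := p :+ (x :- r)) refl

    spanned-cycles : ∀ {m} (γ : Fin m → C1) →
                     (∀ {x y} → inU x ≡ true → inU y ≡ false → Edge x y → Spanned γ (loop₄ bU x y bV)) →
                     ∀ {z} → IsCycle z → Spanned γ z
    spanned-cycles γ squares {z} cyc =
      spanned-homologous γ (homologous-≐ (cycle-≐-expand-closedUp cyc)) (spanned-expand γ z closedUp-spanned)
      where
      closedUp-spanned : ∀ i j → lt i j ≡ true → Edge i j → Spanned γ (closedUp i j)
      closedUp-spanned i j _ e with side i | side j
      ... | inj₁ i∈ | inj₁ j∈ = spanned-boundary γ (boundary-resp (closedUp-UU i∈ j∈)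
              (loop₃-boundary (adjOrEq-sameSide (sameSide (bU∈U i i∈) i∈)) (inj₂ e)
                              (adjOrEq-sameSide (sameSide (bU∈U j j∈) j∈))))
      ... | inj₂ i∈ | inj₂ j∈ = spanned-boundary γ (boundary-resp (closedUp-VV i∈ j∈)
              (loop₃-boundary (adjOrEq-sameSide (sameSide (bV∈V i i∈) i∈)) (inj₂ e)
                              (adjOrEq-sameSide (sameSide (bV∈V j j∈) j∈))))
      ... | inj₁ i∈ | inj₂ j∈ = spanned-homologous γ (homologous-≐ (closedUp-UV i∈ j∈)) (squares i∈ j∈ e)
      ... | inj₂ i∈ | inj₁ j∈ = spanned-homologous γ (homologous-≐ (closedUp-VU i∈ j∈))
              (spanned-neg γ (squares j∈ i∈ (Edge-sym e)))

  module Squares (bU bV : Fin n) (bU∈U : inU bU ≡ true) (bV∈V : inU bV ≡ false) where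

    square : Fin n → Fin n → C1
    square x y = loop₄ bU x y bV

    square-moveV : ∀ {x y y′} → inU y ≡ false → inU y′ ≡ false → Edge x y → Edge x y′ →
                   Homologous (square x y) (square x y′)
    square-moveV {x} {y} {y′} y∈V y′∈V xy xy′ =
      homologous-trans (homologous-≐ (≐-pointwise split))
        (homologous-+boundary (boundary-+
          (loop₃-boundary (inj₂ xy) (adjOrEq-sameSide (sameSide y∈V y′∈V)) (inj₂ xy′))
          (loop₃-boundary (adjOrEq-sameSide (sameSide bV∈V y′∈V)) (adjOrEq-sameSide (sameSide y′∈V y∈V))
                          (adjOrEq-sameSide (sameSide bV∈V y∈V)))))
      where
      split : ∀ a b → square x y a b ≈ (square x y′ +C (loop₃ x y y′ +C loop₃ bV y′ y)) a b
      split a b = sym (trans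
        (+-congˡ (+-cong (+-congˡ (+-congˡ (orientedEdge-anti x y′ a b)))
                         (+-cong (orientedEdge-anti y′ bV a b) (+-congʳ (orientedEdge-anti y y′ a b)))))
        (cancel (E bU x a b) (E x y a b) (E y bV a b) (E bV bU a b) (E x y′ a b) (E y′ bV a b) (E y y′ a b)))
        where
        cancel : ∀ p q r s q′ r′ w → (p + (q′ + (r′ + s))) + ((q + (w + - q′)) + (- r′ + (- w + r))) ≈ p + (q + (r + s))
        cancel = solve 7 (λ p q r s q′ r′ w →
          (p :+ (q′ :+ (r′ :+ s))) :+ ((q :+ (w :+ :- q′)) :+ (:- r′ :+ (:- w :+ r))) := p :+ (q :+ (r :+ s))) refl

    square-moveU : ∀ {x x′ y} → inU x ≡ true → inU x′ ≡ true → Edge x y → Edge x′ y →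
                   Homologous (square x y) (square x′ y)
    square-moveU {x} {x′} {y} x∈U x′∈U xy x′y =
      homologous-trans (homologous-≐ (≐-pointwise split))
        (homologous-+boundary (boundary-+
          (loop₃-boundary (adjOrEq-sameSide (sameSide bU∈U x∈U)) (adjOrEq-sameSide (sameSide x∈U x′∈U))
                          (adjOrEq-sameSide (sameSide bU∈U x′∈U)))
          (loop₃-boundary (adjOrEq-sameSide (sameSide x′∈U x∈U)) (inj₂ xy) (inj₂ x′y))))
      where
      split : ∀ a b → square x y a b ≈ (square x′ y +C (loop₃ bU x x′ +C loop₃ x′ x y)) a b
      split a b = sym (trans
        (+-congˡ (+-cong (+-congˡ (+-congˡ (orientedEdge-anti bU x′ a b)))
                         (+-cong (orientedEdge-anti x x′ a b) (+-congˡ (orientedEdge-anti x′ y a b)))))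
        (cancel (E bU x a b) (E x y a b) (E y bV a b) (E bV bU a b) (E bU x′ a b) (E x′ y a b) (E x x′ a b)))
        where
        cancel : ∀ p q r s p′ q′ w → (p′ + (q′ + (r + s))) + ((p + (w + - p′)) + (- w + (q + - q′))) ≈ p + (q + (r + s))
        cancel = solve 7 (λ p q r s p′ q′ w →
          (p′ :+ (q′ :+ (r :+ s))) :+ ((p :+ (w :+ :- p′)) :+ (:- w :+ (q :+ :- q′))) := p :+ (q :+ (r :+ s))) refl

    CrossSquare≈ : Fin n → Fin n → Fin n → Fin n → Set (c ⊔ ℓ)
    CrossSquare≈ x₀ y₀ w w′ = (inU w ≡ true  → Homologous (square w w′) (square x₀ y₀)) ×
                              (inU w ≡ false → Homologous (square w′ w) (square x₀ y₀))

    square-connected : ∀ {x₀ y₀} → inU x₀ ≡ true → inU y₀ ≡ false → Edge x₀ y₀ →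
                       ∀ {w} → Conn' inU w x₀ → ∀ {w′} → CrossEdge inU w w′ → CrossSquare≈ x₀ y₀ w w′
    square-connected x₀∈U y₀∈V x₀y₀ ε w~w′@(e , _) =
      (λ w∈U → square-moveV (crossEdge-to-V w~w′ w∈U) y₀∈V e x₀y₀) ,
      (λ w∈V → ⊥-elim (true≢false (≡.trans (≡.sym x₀∈U) w∈V)))
    square-connected {x₀} {y₀} x₀∈U y₀∈V x₀y₀ {w} (_◅_ {j = w₁} w~w₁@(e₁ , _) path) w~w′@(e , _) =
      (λ w∈U → homologous-trans (square-moveV (crossEdge-to-V w~w′ w∈U) (crossEdge-to-V w~w₁ w∈U) e e₁)
                                (proj₂ IH (crossEdge-to-V w~w₁ w∈U))) ,
      (λ w∈V → homologous-trans (square-moveU (crossEdge-to-U w~w′ w∈V) (crossEdge-to-U w~w₁ w∈V) (Edge-sym e) (Edge-sym e₁))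
                                (proj₁ IH (crossEdge-to-U w~w₁ w∈V)))
      where
      IH : CrossSquare≈ x₀ y₀ w₁ w
      IH = square-connected x₀∈U y₀∈V x₀y₀ path (crossEdge-sym w~w₁)

module CrossComponents {c ℓ : Level} (F : Field c ℓ) {n : ℕ} (G : Graph n) (inU : Fin n → Bool)
                  (cliques : GraphNotions.CliqueSides G inU)
                  {p : ℕ} (u v : Fin (suc p) → Fin n)
                  (reps : GraphNotions.ComponentReps G inU (suc p) u v) where
  open Field F hiding (zero)
  open Graph G
  open Homology F G
  open GraphNotions.ComponentReps reps
  open FlagComplex F G
  open TwoCliques F G inU cliques
  open IntegerCoefficients commRing using (solve; _:=_; _:+_; _:*_; :-_; _:-_; con)
  open import Algebra.Properties.Ring ring using (+-inverseˡ-unique; -‿distribʳ-*)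
  open import Relation.Binary.Reasoning.Setoid setoid

  u₀ v₀ : Fin n
  u₀ = u zero
  v₀ = v zero

  open Squares u₀ v₀ (u-in-U zero) (v-in-V zero)

  γ : Fin p → C1
  γ k = square (u (suc k)) (v (suc k))

  rep-crossEdge : ∀ k → CrossEdge inU (u k) (v k)
  rep-crossEdge k = crossEdge (u-in-U k) (v-in-V k) (rep-edge k)

  square-u₀v₀ : square u₀ v₀ ≐ zeroC
  square-u₀v₀ = ≐-pointwise λ a b → begin
    E u₀ u₀ a b + (E u₀ v₀ a b + (E v₀ v₀ a b + E v₀ u₀ a b))
      ≈⟨ +-cong (orientedEdge-self u₀ a b) (+-congˡ (+-cong (orientedEdge-self v₀ a b) (orientedEdge-anti u₀ v₀ a b))) ⟩
    0# + (E u₀ v₀ a b + (0# + - E u₀ v₀ a b))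
      ≈⟨ cancel (E u₀ v₀ a b) ⟩
    0# ∎
    where
    E : Fin n → Fin n → C1
    E = orientedEdge
    cancel : ∀ x → 0# + (x + (0# + - x)) ≈ 0#
    cancel = solve 1 (λ x → con (+ 0) :+ (x :+ (con (+ 0) :+ :- x)) := con (+ 0)) refl

  squares-spanned : ∀ {x y} → inU x ≡ true → inU y ≡ false → Edge x y → Spanned γ (square x y)
  squares-spanned {x} {y} x∈U y∈V e with cover x y (crossEdge x∈U y∈V e)
  ... | k , x⇝uk = spanned-homologous γ
    (proj₁ (square-connected (u-in-U k) (v-in-V k) (rep-edge k) x⇝uk (crossEdge x∈U y∈V e)) x∈U)
    (rep-spanned k)
    where
    rep-spanned : ∀ k → Spanned γ (square (u k) (v k))
    rep-spanned zero    = spanned-boundary γ (boundary-resp square-u₀v₀ (homologous-refl zeroC))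
    rep-spanned (suc l) = spanned-generator γ l

  cycles-spanned : ∀ z → IsCycle z → Σ (Fin p → Carrier) (λ a → Homologous z (linComb a γ))
  cycles-spanned z = Potential.spanned-cycles u₀ v₀ (λ _ _ → u-in-U zero) (λ _ _ → v-in-V zero) γ squares-spanned

  u₀≢u : ∀ l → u₀ ≢ u (suc l)
  u₀≢u l u₀≡ with distinct zero (suc l) (≡.subst (Conn' inU u₀) u₀≡ ε)
  ... | ()

  v≢v₀ : ∀ l → v (suc l) ≢ v₀
  v≢v₀ l v≡ with distinct zero (suc l)
    (rep-crossEdge zero ◅ ≡.subst (λ x → Conn' inU x (u (suc l))) v≡ (crossEdge-sym (rep-crossEdge (suc l)) ◅ ε))
  ... | ()

  module _ (l : Fin p) where
    private
      uₗ vₗ : Fin n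
      uₗ = u (suc l)
      vₗ = v (suc l)

    γ-edge₁ : Edge u₀ uₗ
    γ-edge₁ = cliques u₀ uₗ (u₀≢u l) (sameSide (u-in-U zero) (u-in-U (suc l)))

    γ-edge₃ : Edge vₗ v₀
    γ-edge₃ = cliques vₗ v₀ (v≢v₀ l) (sameSide (v-in-V (suc l)) (v-in-V zero))

    pair-γ : ∀ {x} → Alternating x → ⟨ x , γ l ⟩ ≈ x u₀ uₗ + (x uₗ vₗ + (x vₗ v₀ + x v₀ u₀))
    pair-γ alt = pair-loop₄ alt γ-edge₁ (rep-edge (suc l)) γ-edge₃ (Edge-sym (rep-edge zero))

    γ-cycle : IsCycle (γ l)
    γ-cycle w = begin
      ∂₁ (γ l) w                              ≈⟨ ∂₁-pairing (γ l) w ⟩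
      ⟨ γ l , coboundary δ ⟩                  ≈⟨ pair-comm (γ l) (coboundary δ) ⟩
      ⟨ coboundary δ , γ l ⟩                  ≈⟨ pair-γ (coboundary-alternating δ) ⟩
      (δ uₗ - δ u₀) + ((δ vₗ - δ uₗ) + ((δ v₀ - δ vₗ) + (δ u₀ - δ v₀)))
                                              ≈⟨ telescope (δ u₀) (δ uₗ) (δ vₗ) (δ v₀) ⟩
      0#                                      ∎
      where
      δ : Fin n → Carrier
      δ = indicator w
      telescope : ∀ a b c d → (b - a) + ((c - b) + ((d - c) + (a - d))) ≈ 0#
      telescope = solve 4 (λ a b c d → (b :- a) :+ ((c :- b) :+ ((d :- c) :+ (a :- d))) := con (+ 0)) refl

  module ComponentCocycle (m : Fin (suc p)) where

    indicatorAt : ∀ a → Dec (Σ (Fin n) (CrossEdge inU a)) → Carrier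
    indicatorAt a (yes (y , a~y)) = indicator m (proj₁ (cover a y a~y))
    indicatorAt a (no _)          = 0#

    χ : Fin n → Carrier
    χ a = indicatorAt a (Fin.any? (crossEdge? a))

    χ-rep : ∀ {a y k} → Conn' inU a (u k) → CrossEdge inU a y → χ a ≡ indicator m k
    χ-rep {a} {y} {k} a⇝uk a~y with Fin.any? (crossEdge? a)
    ... | yes (y′ , a~y′) = ≡.cong (indicator m) (distinct _ _ (reverse crossEdge-sym (proj₂ (cover a y′ a~y′)) ◅◅ a⇝uk))
    ... | no  no-cross    = ⊥-elim (no-cross (y , a~y))

    χ-crossEdge : ∀ {a b} → CrossEdge inU a b → χ a ≡ χ b
    χ-crossEdge {a} {b} a~b with cover a b a~b
    ... | k , a⇝uk = ≡.trans (χ-rep a⇝uk a~b) (≡.sym (χ-rep (crossEdge-sym a~b ◅ a⇝uk) (crossEdge-sym a~b)))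

    inV : Fin n → Carrier
    inV x = guard (not (inU x)) 1#

    inV-side : ∀ {x b} → inU x ≡ b → inV x ≡ guard (not b) 1#
    inV-side = ≡.cong (λ s → guard (not s) 1#)

    -- φ = χ ⌣ δs, so δφ = δχ ⌣ δs; it vanishes on every triangle because χ is constant along
    -- the cross edges, which are the only edges across which s jumps.
    φ : C1
    φ a b = χ a * (inV b - inV a)

    flatˡ : ∀ {x y z} → x ≡ y → (y - x) * z ≈ 0#
    flatˡ ≡.refl = trans (*-congʳ (-‿inverseʳ _)) (zeroˡ _)

    flatʳ : ∀ {x y z} → x ≡ y → z * (x - y) ≈ 0#
    flatʳ ≡.refl = trans (*-congˡ (-‿inverseʳ _)) (zeroʳ _)

    jump-vanishes : ∀ {a b c} → AdjOrEq a b → AdjOrEq b c → AdjOrEq a c → (χ b - χ a) * (inV c - inV b) ≈ 0#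
    jump-vanishes {a} {b} {c} a~b b~c a~c with inU a Bool.≟ inU b
    ... | no sides = flatˡ (χ-crossEdge (adjOrEq-crossEdge a~b sides))
    ... | yes same with inU b Bool.≟ inU c
    ...   | yes same′ = flatʳ (inV-side (≡.sym same′))
    ...   | no sides  = flatˡ (≡.trans (χ-crossEdge (adjOrEq-crossEdge a~c (λ ac → sides (≡.trans (≡.sym same) ac))))
                                       (≡.sym (χ-crossEdge (adjOrEq-crossEdge b~c sides))))

    φ-cocycle : IsCocycle φ
    φ-cocycle a b c _ _ abc with ∧-true abc
    ... | ab , bc∧ac with ∧-true {adj b c} bc∧ac
    ...   | bc , ac = trans (δφ≈jump (χ a) (χ b) (inV a) (inV b) (inV c)) (jump-vanishes (inj₂ ab) (inj₂ bc) (inj₂ ac))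
      where
      δφ≈jump : ∀ x y r s t → (y * (t - s) - x * (t - r)) + x * (s - r) ≈ (y - x) * (t - s)
      δφ≈jump = solve 5 (λ x y r s t → (y :* (t :- s) :- x :* (t :- r)) :+ x :* (s :- r) := (y :- x) :* (t :- s)) refl

    φ-alternating : Alternating φ
    φ-alternating a b e = +-inverseˡ-unique (φ b a) (φ a b)
      (trans (swap≈jump (χ a) (χ b) (inV a) (inV b)) (jump-vanishes (inj₂ e) (inj₂ (Edge-sym e)) (inj₁ ≡.refl)))
      where
      swap≈jump : ∀ x y r s → y * (r - s) + x * (s - r) ≈ (y - x) * (r - s)
      swap≈jump = solve 4 (λ x y r s → y :* (r :- s) :+ x :* (s :- r) := (y :- x) :* (r :- s)) refl

    φ-same : ∀ {x y} → inU x ≡ inU y → φ x y ≈ 0#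
    φ-same same = flatʳ (inV-side (≡.sym same))

    φ-UV : ∀ {x y} → inU x ≡ true → inU y ≡ false → φ x y ≈ χ x
    φ-UV x∈U y∈V = trans (*-congˡ (+-cong (reflexive (inV-side y∈V)) (-‿cong (reflexive (inV-side x∈U)))))
                         (trans (*-congˡ (x-0≈x 1#)) (*-identityʳ _))

    φ-VU : ∀ {x y} → inU x ≡ false → inU y ≡ true → φ x y ≈ - χ x
    φ-VU x∈V y∈U = trans (*-congˡ (+-cong (reflexive (inV-side y∈U)) (-‿cong (reflexive (inV-side x∈V)))))
                         (trans (*-congˡ (+-identityˡ _)) (trans (sym (-‿distribʳ-* _ _)) (-‿cong (*-identityʳ _))))

    pair-φ-γ : ∀ l → ⟨ φ , γ l ⟩ ≈ indicator m (suc l) - indicator m zero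
    pair-φ-γ l = begin
      ⟨ φ , γ l ⟩
        ≈⟨ pair-γ l φ-alternating ⟩
      φ u₀ uₗ + (φ uₗ vₗ + (φ vₗ v₀ + φ v₀ u₀))
        ≈⟨ +-cong (φ-same (sameSide (u-in-U zero) (u-in-U (suc l))))
                  (+-cong (φ-UV (u-in-U (suc l)) (v-in-V (suc l)))
                          (+-cong (φ-same (sameSide (v-in-V (suc l)) (v-in-V zero))) (φ-VU (v-in-V zero) (u-in-U zero)))) ⟩
      0# + (χ uₗ + (0# + - χ v₀))
        ≈⟨ drop-zeros (χ uₗ) (χ v₀) ⟩
      χ uₗ - χ v₀
        ≡⟨ ≡.cong₂ _-_ (χ-rep ε (rep-crossEdge (suc l)))
                       (χ-rep (crossEdge-sym (rep-crossEdge zero) ◅ ε) (crossEdge-sym (rep-crossEdge zero))) ⟩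
      indicator m (suc l) - indicator m zero ∎
      where
      uₗ vₗ : Fin n
      uₗ = u (suc l)
      vₗ = v (suc l)
      drop-zeros : ∀ x y → 0# + (x + (0# + - y)) ≈ x - y
      drop-zeros = solve 2 (λ x y → con (+ 0) :+ (x :+ (con (+ 0) :+ :- y)) := x :- y) refl

  γ-independent : ∀ a → Homologous (linComb a γ) zeroC → ∀ k → a k ≈ 0#
  γ-independent a a·γ~0 k = begin
    a k                                           ≈⟨ sum-δ k a ⟨
    sumF (λ l → guard (toℕ l ≡ᵇ toℕ k) (a l))     ≈⟨ sum-cong picks ⟨
    sumF (λ l → a l * ⟨ φ , γ l ⟩)                ≈⟨ pair-linComb φ a γ ⟨
    ⟨ φ , linComb a γ ⟩                           ≈⟨ cocycle-pair-homologous φ-cocycle a·γ~0 ⟩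
    ⟨ φ , zeroC ⟩                                 ≈⟨ lin-0 (pair-linear φ) ⟩
    0#                                            ∎
    where
    open ComponentCocycle (suc k)
    picks : ∀ l → a l * ⟨ φ , γ l ⟩ ≈ guard (toℕ l ≡ᵇ toℕ k) (a l)
    picks l = trans (*-congˡ (trans (pair-φ-γ l) (x-0≈x _))) (trans (*-comm _ _) (guard-1-* (toℕ l ≡ᵇ toℕ k) (a l)))

-- When no vertex satisfies P x ≡ b the witness is an arbitrary vertex; the implication
-- then holds vacuously.
representative : ∀ {n} (P : Fin (suc n) → Bool) b → Σ (Fin (suc n)) λ r → ∀ x → P x ≡ b → P r ≡ b
representative P b with Fin.any? (λ x → P x Bool.≟ b)
... | yes (r , Pr≡b) = r , λ _ _ → Pr≡b
... | no  none       = zero , λ x Px≡b → ⊥-elim (none (x , Px≡b))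

betti₁-without-crossEdges : ∀ {c ℓ} (F : Field c ℓ) n (G : Graph n) (inU : Fin n → Bool) →
  Homology.CliqueSides F G inU → (∀ x y → ¬ Homology.CrossEdge F G inU x y) → Homology.Betti1 F G 0
betti₁-without-crossEdges F zero    G inU cliques none =
  (λ ()) , (λ ()) , (λ _ _ → (λ ()) , (λ ()) , λ ()) , λ _ _ ()
betti₁-without-crossEdges F (suc n) G inU cliques none =
  (λ ()) , (λ ()) , (λ _ → spanned-cycles (λ ()) λ x∈U y∈V e → ⊥-elim (none _ _ (crossEdge x∈U y∈V e))) , λ _ _ ()
  where
  open TwoCliques F G inU cliques
  open Potential (proj₁ (representative inU _)) (proj₁ (representative inU _))
                 (proj₂ (representative inU _)) (proj₂ (representative inU _))

squares-basis : ∀ {c ℓ} (F : Field c ℓ) {n} (G : Graph n) (inU : Fin n → Bool) →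
  Homology.CliqueSides F G inU → ∀ {p} (u v : Fin (suc p) → Fin n) → Homology.ComponentReps F G inU (suc p) u v →
  Homology.IsH1Basis F G p (λ k → Homology.closedWalk F G (u zero ∷ u (suc k) ∷ v (suc k) ∷ v zero ∷ []))
squares-basis F G inU cliques u v reps = γ-cycle , cycles-spanned , γ-independent
  where open CrossComponents F G inU cliques u v reps

lemma3p3 : ∀ {c ℓ : Level} (F : Field c ℓ) (n : ℕ) (G : Graph n) (inU : Fin n → Bool) →
    Homology.CliqueSides F G inU →
    (∀ (q : ℕ) (u v : Fin q → Fin n) → Homology.ComponentReps F G inU q u v →
      Homology.Betti1 F G (q ∸ 1))
    × (∀ (p : ℕ) (u v : Fin (suc p) → Fin n) → Homology.ComponentReps F G inU (suc p) u v →
      Homology.IsH1Basis F G p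
        (λ k → Homology.closedWalk F G (u zero ∷ u (suc k) ∷ v (suc k) ∷ v zero ∷ [])))
lemma3p3 F n G inU cliques = betti₁ , λ p u v → squares-basis F G inU cliques u v
  where
  betti₁ : ∀ q (u v : Fin q → Fin n) → Homology.ComponentReps F G inU q u v → Homology.Betti1 F G (q ∸ 1)
  betti₁ zero    u v reps = betti₁-without-crossEdges F n G inU cliques λ x y x~y →
    Fin.¬Fin0 (proj₁ (GraphNotions.ComponentReps.cover reps x y x~y))
  betti₁ (suc p) u v reps = _ , squares-basis F G inU cliques u v reps
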